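{- (1) Let $f(D)$ be a delta operator with associated graded sequence $(p_a^\alpha(x))$. Then for every Artinian operator $g(D)$ and every logarithmic index $\alpha\ne(0)$ the following series converges and $$g\bigl(f^{(-1)}\bigr)=\sum_b\frac{\langle\alpha\mid g(D)p_b^\alpha(x)\rangle}{\lfloor b\rceil!}D^b.$$ (2) The same identity holds for $\alpha=(0)$ whenever $g(D)$ is a differential operator.
   Context: Setting (discrete case of the logarithmic umbral calculus). For $a\in\mathbb{Z}$ let $\lfloor a\rceil=a$ if $a\neq0$, $\lfloor 0\rceil=1$; $\lfloor a\rceil!=a!$ for $a\ge0$, $\lfloor a\rceil!=(-1)^{ -a-1}/(-a-1)!$ for $a<0$. Harmonic logarithms $\lambda_a^\alpha(x)$ ($a\in\mathbb{Z}$, $\alpha$ a logarithmic index): $\lambda_a^{(0)}=x^a$ for $a\ge0$, $0$ for $a<0$; $\lambda_a^{(1)}=x^a(\log x-H_a)$ for $a\ge0$, $x^a$ for $a<0$; higher indices involve iterated logarithms. $\mathcal{I}^\alpha$: formal series $\sum_{b\le N}c_b\lambda_b^\alpha$. $D\lambda_a^\alpha=\lfloor a\rceil\lambda_{a-1}^\alpha$; Artinian operators $\sum_{a\ge k}c_aD^a$ ($k\in\mathbb{Z}$; a field, with the topology of formal Laurent series) act via $D^b\lambda_a^\alpha=\frac{\lfloor a\rceil!}{\lfloor a-b\rceil!}\lambda_{a-b}^\alpha$; differential operators are those $\sum_{a\ge0}c_aD^a$; delta operators are $\sum_{a\ge1}c_aD^a$ with $c_1\ne0$; composition $g(h)=\sum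 c_ah(D)^a$ for $g=\sum c_aD^a$ and a delta operator $h$; $f^{(-1)}$ is the compositional inverse of $f$. $\langle\alpha\mid p\rangle$ = coefficient of $\lambda_0^\alpha$ in $p$. A graded sequence is a regular family $(p_a^\alpha)$, $p_a^\alpha\in\mathcal{I}^\alpha$ of degree $a$ (coefficients independent of $\alpha\ne(0)$; $p_a^{(0)}$ obtained from $p_a^{(1)}$ by $\lambda_b^{(1)}\mapsto\lambda_b^{(0)}$). The associated graded sequence of a delta operator $f(D)$ is the unique graded sequence with $\langle\alpha\mid p_0^\alpha\rangle=1$, $\langle\alpha\mid p_a^\alpha\rangle=0$ ($a\ne0$), $f(D)p_a^\alpha=\lfloor a\rceil p_{a-1}^\alpha$. -}

module Defs where

open import Level using (Level; _⊔_) renaming (suc to lsuc)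
open import Algebra.Bundles using (CommutativeRing)
open import Data.Bool using (if_then_else_)
open import Data.Nat as ℕ using (ℕ; zero; suc; _!)
open import Data.Integer as ℤ using (ℤ; +_; -[1+_]; 0ℤ; 1ℤ; -1ℤ)
import Data.Integer.Properties as ℤP
import Data.Nat.Properties as ℕP
open import Data.Product using (_×_)
open import Relation.Nullary using (¬_; does)
open import Relation.Binary.PropositionalEquality using (_≢_)

natK : ∀ {c ℓ} (R : CommutativeRing c ℓ) → ℕ → CommutativeRing.Carrier R
natK R zero    = CommutativeRing.0# R
natK R (suc n) = CommutativeRing._+_ R (CommutativeRing.1# R) (natK R n)

record CharZeroField c ℓ : Set (lsuc (c ⊔ ℓ)) where
  field
    cring : CommutativeRing c ℓ
  open CommutativeRing cring public
  field
    _⁻¹        : Carrier → Carrier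
    0≉1        : ¬ (0# ≈ 1#)
    ⁻¹-inverse : ∀ x → ¬ (x ≈ 0#) → (x * (x ⁻¹)) ≈ 1#
    charZero   : ∀ n → ¬ (natK cring (suc n) ≈ 0#)

module Umbral {c ℓ} (F : CharZeroField c ℓ) where
  open CharZeroField F using (Carrier; _≈_; _+_; _*_; -_; 0#; 1#; _⁻¹; cring)

  K : Set c
  K = Carrier

  sumN : ℕ → (ℕ → K) → K
  sumN zero    f = 0#
  sumN (suc n) f = f zero + sumN n (λ i → f (suc i))

  toℕ⁺ : ℤ → ℕ
  toℕ⁺ (+ n)    = n
  toℕ⁺ -[1+ _ ] = 0

  -- Σ_{lo ≤ i ≤ hi} f i   (empty if hi < lo)
  sumZ : ℤ → ℤ → (ℤ → K) → K
  sumZ lo hi f = sumN (toℕ⁺ (hi ℤ.- lo ℤ.+ 1ℤ)) (λ i → f (lo ℤ.+ + i))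

  intK : ℤ → K
  intK (+ n)    = natK cring n
  intK -[1+ n ] = - natK cring (suc n)

  brk : ℤ → K
  brk a = if does (a ℤ.≟ 0ℤ) then 1# else intK a

  negOnePow : ℕ → K
  negOnePow zero    = 1#
  negOnePow (suc n) = - negOnePow n

  -- ⌊a⌉! = a! (a ≥ 0),  (-1)^(-a-1) / (-a-1)!  (a < 0)
  brkFact : ℤ → K
  brkFact (+ n)    = natK cring (n !)
  brkFact -[1+ n ] = negOnePow n * (natK cring (n !)) ⁻¹

  ratio : ℤ → ℤ → K
  ratio x b = brkFact x * (brkFact (x ℤ.- b)) ⁻¹

  -- Artinian operators  Σ_{a ≥ ord} c_a D^a  (formal Laurent series in D).
  -- 'ord' is a lower bound of the support; raw coefficients below
  -- 'ord' are ignored (read as 0).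
  record LS : Set c where
    field
      ord : ℤ
      raw : ℤ → K

  coeff : LS → ℤ → K
  coeff s n = if does (n ℤ.<? LS.ord s) then 0# else LS.raw s n

  _≈L_ : LS → LS → Set ℓ
  s ≈L t = ∀ n → coeff s n ≈ coeff t n

  oneL : LS
  oneL = record { ord = 0ℤ ; raw = λ n → if does (n ℤ.≟ 0ℤ) then 1# else 0# }

  DL : LS
  DL = record { ord = 1ℤ ; raw = λ n → if does (n ℤ.≟ 1ℤ) then 1# else 0# }

  mulL : LS → LS → LS
  mulL s t = record
    { ord = LS.ord s ℤ.+ LS.ord t
    ; raw = λ n → sumZ (LS.ord s) (n ℤ.- LS.ord t)
                       (λ i → coeff s i * coeff t (n ℤ.- i)) }

  -- inverse of a power series u (with u 0 invertible):
  -- v 0 = u0⁻¹,  v n = - u0⁻¹ Σ_{i=1}^{n} u i · v (n-i)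
  invStage : (ℕ → K) → ℕ → ℕ → K
  invStage u zero    j = (u 0) ⁻¹
  invStage u (suc n) j =
    if does (j ℕ.≤? n) then invStage u n j
    else - ((u 0) ⁻¹ * sumN (suc n) (λ i → u (suc i) * invStage u n (n ℕ.∸ i)))

  psInv : (ℕ → K) → ℕ → K
  psInv u j = invStage u j j

  -- multiplicative inverse of a delta operator h = D·u:  h⁻¹ = D⁻¹ u⁻¹
  invDelta : LS → LS
  invDelta h = record
    { ord = -1ℤ
    ; raw = λ n → psInv (λ i → coeff h (+ suc i)) (toℕ⁺ (n ℤ.+ 1ℤ)) }

  powN : LS → ℕ → LS
  powN h zero    = oneL
  powN h (suc n) = mulL h (powN h n)

  powZ : LS → ℤ → LS
  powZ h (+ n)    = powN h n
  powZ h -[1+ n ] = powN (invDelta h) (suc n)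

  -- composition g(h) = Σ_a g_a h^a for a delta operator h; since h^a has
  -- order a, the coefficient of D^m only involves ord g ≤ a ≤ m.
  comp : LS → LS → LS
  comp g h = record
    { ord = LS.ord g
    ; raw = λ m → sumZ (LS.ord g) m (λ a → coeff g a * coeff (powZ h a) m) }

  IsDelta : LS → Set ℓ
  IsDelta f = (∀ n → n ℤ.< 1ℤ → coeff f n ≈ 0#) × ¬ (coeff f 1ℤ ≈ 0#)

  IsDifferential : LS → Set ℓ
  IsDifferential g = ∀ n → n ℤ.< 0ℤ → coeff g n ≈ 0#

  IsCompInverse : LS → LS → Set ℓ
  IsCompInverse f h = IsDelta h × (comp f h ≈L DL) × (comp h f ≈L DL)

  -- Elements of I^α : Σ_{b ≤ top} c_b λ_b^α, stored by coefficients.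
  -- For α ≠ (0) all I^α are modelled by the same coefficient space;
  -- α = (0) is modelled through truncation (λ_b^(0) = 0 for b < 0).
  record Elt : Set c where
    field
      top : ℤ
      raw : ℤ → K

  coeffI : Elt → ℤ → K
  coeffI p b = if does (Elt.top p ℤ.<? b) then 0# else Elt.raw p b

  _≈E_ : Elt → Elt → Set ℓ
  p ≈E q = ∀ b → coeffI p b ≈ coeffI q b

  scaleE : K → Elt → Elt
  scaleE k p = record { top = Elt.top p ; raw = λ b → k * coeffI p b }

  -- ⟨α | p⟩ = coefficient of λ_0^α
  pair : Elt → K
  pair p = coeffI p 0ℤ

  -- action of an Artinian operator on I^α, α ≠ (0):
  --   D^a λ_b = ⌊b⌉!/⌊b-a⌉! λ_{b-a}
  act : LS → Elt → Elt
  act g p = record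
    { top = Elt.top p ℤ.- LS.ord g
    ; raw = λ m → sumZ (LS.ord g) (Elt.top p ℤ.- m)
                     (λ a → coeff g a * coeffI p (m ℤ.+ a) * ratio (m ℤ.+ a) a) }

  -- λ_b^(1) ↦ λ_b^(0)  (kills the terms with b < 0)
  trunc : Elt → Elt
  trunc p = record
    { top = Elt.top p
    ; raw = λ b → if does (b ℤ.<? 0ℤ) then 0# else coeffI p b }

  act0 : LS → Elt → Elt
  act0 g p = trunc (act g (trunc p))

  HasDegree : Elt → ℤ → Set ℓ
  HasDegree p a = ¬ (coeffI p a ≈ 0#) × (∀ b → a ℤ.< b → coeffI p b ≈ 0#)

  -- (p a)_a is the associated graded sequence of the delta operator f
  -- (p a = the common coefficients of p_a^α, α ≠ (0); p_a^(0) = trunc (p a))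
  IsAssociated : LS → (ℤ → Elt) → Set ℓ
  IsAssociated f p =
      (∀ a → HasDegree (p a) a)
    × (pair (p 0ℤ) ≈ 1#)
    × (∀ a → a ≢ 0ℤ → pair (p a) ≈ 0#)
    × (∀ a → act f (p a) ≈E scaleE (brk a) (p (a ℤ.- 1ℤ)))
    × (pair (trunc (p 0ℤ)) ≈ 1#)
    × (∀ a → a ≢ 0ℤ → pair (trunc (p a)) ≈ 0#)
    × (∀ a → act0 f (trunc (p a)) ≈E scaleE (brk a) (trunc (p (a ℤ.- 1ℤ))))

-- Let h = f⁽⁻¹⁾ and let Q a b be the coefficient of D^b in h^a, so that the
-- coefficient of D^b in g(h) = Σ_a g_a h^a is Σ_a g_a Q a b.  Writing c b a for
-- the coefficient of λ_a in p_b, the pairing ⟨α | g(D) p_b⟩ is Σ_a g_a c b a ⌊a⌉!.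
-- So it suffices to show Q a b ⌊b⌉! = c b a ⌊a⌉!.  Both arrays vanish for b < a,
-- agree in the column a = 0 (there ⟨α | p_b⟩ = δ_b0), and satisfy the same
-- recurrence Σ_{k ≥ 1} f_k Z b (m + k) = ⌊b⌉ Z (b - 1) m: for c b a ⌊a⌉! it is
-- f(D) p_b = ⌊b⌉ p_{b-1}, for Q a b ⌊b⌉! it is the coefficient of D^b in
-- f(h) h^m = D h^m (of the two identities f(h) = D = h(f) only the first is used).
-- As f_1 ≠ 0 and ⌊b⌉ ≠ 0, the recurrence propagates each diagonal b - a = d from
-- its entry at a = 0 once the diagonals below it are known, so the two arrays
-- coincide.  For α = (0) and a differential operator g, only the λ_a with a ≥ 0
-- enter ⟨α | g(D) p_b⟩, so truncation changes nothing.

module Submission where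

open import Defs
open import Data.Integer using (ℤ; _<_)
open import Data.Product using (Σ; _×_)

open import Data.Bool using (if_then_else_)
open import Data.Empty using (⊥-elim)
open import Data.Fin using (toℕ)
open import Data.Integer as ℤ using (+_; -[1+_]; 0ℤ; 1ℤ; -1ℤ; _≤_; _⊔_)
import Data.Integer.Properties as ℤ
open import Data.Integer.Tactic.RingSolver using (solve)
open import Data.List using (_∷_; [])
open import Data.Nat as ℕ using (ℕ; zero; suc)
import Data.Nat.Properties as ℕ
open import Data.Product using (∃-syntax; _,_; proj₁; proj₂)
open import Data.Sum using (inj₁; inj₂)
open import Function using (_∘_)
open import Relation.Binary.Bundles using (Setoid)
open import Relation.Binary.PropositionalEquality as ≡ using (_≡_; _≢_)
open import Relation.Nullary using (¬_; Dec; yes; no; does)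

-- Linear side conditions on integers are moved along an equal difference; the
-- difference identity is then a ring identity, left to the solver.
private
  translate-endpoints : ∀ i j k l → l ℤ.- k ≡ j ℤ.- i →
                        i ℤ.+ (k ℤ.- i) ≡ k × j ℤ.+ (k ℤ.- i) ≡ l
  translate-endpoints i j k l eq = solve (i ∷ k ∷ []) , (begin
    j ℤ.+ (k ℤ.- i)   ≡⟨ solve (j ∷ i ∷ k ∷ []) ⟩
    (j ℤ.- i) ℤ.+ k   ≡⟨ ≡.cong (ℤ._+ k) eq ⟨
    (l ℤ.- k) ℤ.+ k   ≡⟨ solve (l ∷ k ∷ []) ⟩
    l                 ∎)
    where open ≡.≡-Reasoning

≤-translate : ∀ {i j k l} → i ≤ j → l ℤ.- k ≡ j ℤ.- i → k ≤ l
≤-translate {i} {j} {k} {l} i≤j eq =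
  ≡.subst₂ _≤_ (proj₁ ends) (proj₂ ends) (ℤ.+-monoˡ-≤ (k ℤ.- i) i≤j)
  where
  ends : i ℤ.+ (k ℤ.- i) ≡ k × j ℤ.+ (k ℤ.- i) ≡ l
  ends = translate-endpoints i j k l eq

<-translate : ∀ {i j k l} → i < j → l ℤ.- k ≡ j ℤ.- i → k < l
<-translate {i} {j} {k} {l} i<j eq =
  ≡.subst₂ _<_ (proj₁ ends) (proj₂ ends) (ℤ.+-monoˡ-< (k ℤ.- i) i<j)
  where
  ends : i ℤ.+ (k ℤ.- i) ≡ k × j ℤ.+ (k ℤ.- i) ≡ l
  ends = translate-endpoints i j k l eq

-- ℤ.suc is opaque to the ring solver, so the successor is spelled out.
<⇒1+≤ : ∀ {i j} → i < j → 1ℤ ℤ.+ i ≤ j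
<⇒1+≤ = ℤ.i<j⇒suc[i]≤j

i≤j⇒∃[d]i+d≡j : ∀ {i j} → i ≤ j → ∃[ d ] i ℤ.+ + d ≡ j
i≤j⇒∃[d]i+d≡j {i} {j} i≤j = ℤ.∣ j ℤ.- i ∣ , (begin
  i ℤ.+ + ℤ.∣ j ℤ.- i ∣
    ≡⟨ ≡.cong (ℤ._+_ i) (ℤ.0≤i⇒+∣i∣≡i (ℤ.i≤j⇒0≤j-i i≤j)) ⟩
  i ℤ.+ (j ℤ.- i)
    ≡⟨ solve (i ∷ j ∷ []) ⟩
  j
    ∎)
  where open ≡.≡-Reasoning

i<j+k⇒i-k<j : ∀ {i j k} → i < j ℤ.+ k → i ℤ.- k < j
i<j+k⇒i-k<j {i} {j} {k} i<j+k = <-translate i<j+k (solve (i ∷ j ∷ k ∷ []))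

i-j<k⇒i-k<j : ∀ i j k → i ℤ.- j < k → i ℤ.- k < j
i-j<k⇒i-k<j i j k i-j<k = <-translate i-j<k (solve (i ∷ j ∷ k ∷ []))

i≤j⇒k-j≤k-i : ∀ {i j} k → i ≤ j → k ℤ.- j ≤ k ℤ.- i
i≤j⇒k-j≤k-i k i≤j = ℤ.+-monoʳ-≤ k (ℤ.neg-mono-≤ i≤j)

ℤ-bidirectional-induction : ∀ {p} (P : ℤ → Set p) → P 0ℤ →
                            (∀ a → P (a ℤ.- 1ℤ) → P a) → (∀ a → P a → P (a ℤ.- 1ℤ)) →
                            ∀ a → P a
ℤ-bidirectional-induction P P0 up down = go
  where
  go : ∀ a → P a
  go (+ zero)      = P0
  go (+ suc n)     = up (+ suc n) (go (+ n))
  go -[1+ zero ]   = down 0ℤ P0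
  go -[1+ suc n ]  = ≡.subst (λ k → P -[1+ suc k ]) (ℕ.+-identityʳ n) (down -[1+ n ] (go -[1+ n ]))

if-true : ∀ {a p} {A : Set a} {P : Set p} (d : Dec P) {x y : A} → P → (if does d then x else y) ≡ x
if-true (yes _) _ = ≡.refl
if-true (no ¬p) p = ⊥-elim (¬p p)

if-false : ∀ {a p} {A : Set a} {P : Set p} (d : Dec P) {x y : A} → ¬ P →
           (if does d then x else y) ≡ y
if-false (yes p) ¬p = ⊥-elim (¬p p)
if-false (no _)  _  = ≡.refl

module _ {c ℓ} (F : CharZeroField c ℓ) where
  open CharZeroField F hiding (zero)
  open Umbral F
  open import Relation.Binary.Reasoning.Setoid setoid
  open import Algebra.Properties.Semiring.Sum semiring
    using (sum; sum-cong-≗; ∑-comm; *-distribˡ-sum; *-distribʳ-sum)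
  open import Algebra.Properties.Semiring.Mult semiring using (×1-homo-*) renaming (_×_ to _×ᵣ_)
  open import Algebra.Properties.Ring ring
    using (-‿distribˡ-*; -‿distribʳ-*; -‿involutive; -0#≈0#; +-cancelʳ)
  open import Algebra.Properties.CommutativeSemigroup *-commutativeSemigroup
    using (interchange; x∙yz≈y∙xz)

  -- Field arithmetic and ⌊a⌉!

  x≈0⇒x*y≈0 : ∀ {x y} → x ≈ 0# → x * y ≈ 0#
  x≈0⇒x*y≈0 {y = y} x≈0 = trans (*-congʳ x≈0) (zeroˡ y)

  y≈0⇒x*y≈0 : ∀ {x y} → y ≈ 0# → x * y ≈ 0#
  y≈0⇒x*y≈0 {x} y≈0 = trans (*-congˡ y≈0) (zeroʳ x)

  1≉0 : 1# ≉ 0#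
  1≉0 1≈0 = 0≉1 (sym 1≈0)

  ⁻¹-inverseˡ : ∀ {x} → x ≉ 0# → x ⁻¹ * x ≈ 1#
  ⁻¹-inverseˡ {x} x≉0 = trans (*-comm _ _) (⁻¹-inverse x x≉0)

  *-cancelˡ : ∀ {x y z} → x ≉ 0# → x * y ≈ x * z → y ≈ z
  *-cancelˡ {x} {y} {z} x≉0 xy≈xz = begin
    y               ≈⟨ *-identityˡ y ⟨
    1# * y          ≈⟨ *-congʳ (⁻¹-inverseˡ x≉0) ⟨
    x ⁻¹ * x * y    ≈⟨ *-assoc _ _ _ ⟩
    x ⁻¹ * (x * y)  ≈⟨ *-congˡ xy≈xz ⟩
    x ⁻¹ * (x * z)  ≈⟨ *-assoc _ _ _ ⟨
    x ⁻¹ * x * z    ≈⟨ *-congʳ (⁻¹-inverseˡ x≉0) ⟩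
    1# * z          ≈⟨ *-identityˡ z ⟩
    z               ∎

  ⁻¹-unique : ∀ {x y} → x ≉ 0# → x * y ≈ 1# → y ≈ x ⁻¹
  ⁻¹-unique x≉0 xy≈1 = *-cancelˡ x≉0 (trans xy≈1 (sym (⁻¹-inverse _ x≉0)))

  ⁻¹-cong : ∀ {x y} → x ≉ 0# → x ≈ y → x ⁻¹ ≈ y ⁻¹
  ⁻¹-cong {x} {y} x≉0 x≈y =
    ⁻¹-unique (λ y≈0 → x≉0 (trans x≈y y≈0)) (trans (*-congʳ (sym x≈y)) (⁻¹-inverse x x≉0))

  *-nonzero : ∀ {x y} → x ≉ 0# → y ≉ 0# → x * y ≉ 0#
  *-nonzero {x} x≉0 y≉0 xy≈0 = y≉0 (*-cancelˡ x≉0 (trans xy≈0 (sym (zeroʳ x))))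

  -‿nonzero : ∀ {x} → x ≉ 0# → - x ≉ 0#
  -‿nonzero {x} x≉0 -x≈0 = x≉0 (trans (sym (-‿involutive x)) (trans (-‿cong -x≈0) -0#≈0#))

  ⁻¹-nonzero : ∀ {x} → x ≉ 0# → x ⁻¹ ≉ 0#
  ⁻¹-nonzero {x} x≉0 x⁻¹≈0 =
    1≉0 (trans (sym (⁻¹-inverse x x≉0)) (trans (*-congˡ x⁻¹≈0) (zeroʳ x)))

  ⁻¹-distrib-* : ∀ {x y} → x ≉ 0# → y ≉ 0# → (x * y) ⁻¹ ≈ x ⁻¹ * y ⁻¹
  ⁻¹-distrib-* {x} {y} x≉0 y≉0 = sym (⁻¹-unique (*-nonzero x≉0 y≉0) (begin
    x * y * (x ⁻¹ * y ⁻¹)  ≈⟨ interchange x y (x ⁻¹) (y ⁻¹) ⟩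
    x * x ⁻¹ * (y * y ⁻¹)  ≈⟨ *-cong (⁻¹-inverse x x≉0) (⁻¹-inverse y y≉0) ⟩
    1# * 1#                ≈⟨ *-identityˡ 1# ⟩
    1#                     ∎))

  -x*-y≈x*y : ∀ x y → - x * - y ≈ x * y
  -x*-y≈x*y x y = begin
    - x * - y    ≈⟨ -‿distribˡ-* x (- y) ⟨
    - (x * - y)  ≈⟨ -‿cong (-‿distribʳ-* x y) ⟨
    - - (x * y)  ≈⟨ -‿involutive _ ⟩
    x * y        ∎

  natK≡×1 : ∀ n → natK cring n ≡ n ×ᵣ 1#
  natK≡×1 zero    = ≡.refl
  natK≡×1 (suc n) = ≡.cong (_+_ 1#) (natK≡×1 n)

  natK-* : ∀ m n → natK cring (m ℕ.* n) ≈ natK cring m * natK cring n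
  natK-* m n rewrite natK≡×1 (m ℕ.* n) | natK≡×1 m | natK≡×1 n = ×1-homo-* m n

  natK-nonzero : ∀ n .{{_ : ℕ.NonZero n}} → natK cring n ≉ 0#
  natK-nonzero (suc n) = charZero n

  factorial-nonzero : ∀ n → natK cring (n ℕ.!) ≉ 0#
  factorial-nonzero n = natK-nonzero (n ℕ.!) {{n ℕ.!≢0}}

  negOnePow-nonzero : ∀ n → negOnePow n ≉ 0#
  negOnePow-nonzero zero    = 1≉0
  negOnePow-nonzero (suc n) = -‿nonzero (negOnePow-nonzero n)

  brk-nonzero : ∀ b → brk b ≉ 0#
  brk-nonzero (+ zero)  = 1≉0
  brk-nonzero (+ suc n) = charZero n
  brk-nonzero -[1+ n ]  = -‿nonzero (charZero n)

  brkFact-nonzero : ∀ b → brkFact b ≉ 0#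
  brkFact-nonzero (+ n)    = factorial-nonzero n
  brkFact-nonzero -[1+ n ] = *-nonzero (negOnePow-nonzero n) (⁻¹-nonzero (factorial-nonzero n))

  brkFact-0 : brkFact 0ℤ ≈ 1#
  brkFact-0 = +-identityʳ 1#

  brkFact-unfold : ∀ b → brkFact b ≈ brk b * brkFact (b ℤ.- 1ℤ)
  brkFact-unfold (+ zero) = trans brkFact-0 (sym (begin
    1# * (1# * (1# + 0#) ⁻¹)  ≈⟨ trans (*-identityˡ _) (*-identityˡ _) ⟩
    (1# + 0#) ⁻¹              ≈⟨ ⁻¹-cong (brkFact-nonzero 0ℤ) brkFact-0 ⟩
    1# ⁻¹                     ≈⟨ ⁻¹-unique 1≉0 (*-identityˡ 1#) ⟨
    1#                        ∎))
  brkFact-unfold (+ suc n) = natK-* (suc n) (n ℕ.!)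
  brkFact-unfold -[1+ n ]  = sym (begin
    - S * brkFact -[1+ suc (n ℕ.+ 0) ]
      ≡⟨ ≡.cong (λ k → - S * brkFact -[1+ suc k ]) (ℕ.+-identityʳ n) ⟩
    - S * (- E * M ⁻¹)     ≈⟨ *-assoc _ _ _ ⟨
    - S * - E * M ⁻¹       ≈⟨ *-congʳ (-x*-y≈x*y S E) ⟩
    S * E * M ⁻¹           ≈⟨ *-congˡ (⁻¹-cong (factorial-nonzero (suc n)) M≈S*N) ⟩
    S * E * (S * N) ⁻¹     ≈⟨ *-congˡ (⁻¹-distrib-* (charZero n) (factorial-nonzero n)) ⟩
    S * E * (S ⁻¹ * N ⁻¹)  ≈⟨ interchange S E (S ⁻¹) (N ⁻¹) ⟩
    S * S ⁻¹ * (E * N ⁻¹)  ≈⟨ *-congʳ (⁻¹-inverse S (charZero n)) ⟩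
    1# * (E * N ⁻¹)        ≈⟨ *-identityˡ _ ⟩
    E * N ⁻¹               ∎)
    where
    S E N M : K
    S = natK cring (suc n)
    E = negOnePow n
    N = natK cring (n ℕ.!)
    M = natK cring (suc n ℕ.!)
    M≈S*N : M ≈ S * N
    M≈S*N = natK-* (suc n) (n ℕ.!)

  ratio-*-brkFact : ∀ x b → ratio x b * brkFact (x ℤ.- b) ≈ brkFact x
  ratio-*-brkFact x b = begin
    brkFact x * brkFact (x ℤ.- b) ⁻¹ * brkFact (x ℤ.- b)
      ≈⟨ *-assoc _ _ _ ⟩
    brkFact x * (brkFact (x ℤ.- b) ⁻¹ * brkFact (x ℤ.- b))
      ≈⟨ *-congˡ (⁻¹-inverseˡ (brkFact-nonzero (x ℤ.- b))) ⟩
    brkFact x * 1#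
      ≈⟨ *-identityʳ _ ⟩
    brkFact x
      ∎

  ratio-self : ∀ a → ratio a a ≈ brkFact a
  ratio-self a = begin
    ratio a a                      ≈⟨ *-identityʳ _ ⟨
    ratio a a * 1#                 ≈⟨ *-congˡ brkFact-0 ⟨
    ratio a a * brkFact 0ℤ         ≡⟨ ≡.cong (λ x → ratio a a * brkFact x) (ℤ.+-inverseʳ a) ⟨
    ratio a a * brkFact (a ℤ.- a)  ≈⟨ ratio-*-brkFact a a ⟩
    brkFact a                      ∎

  -- Finite sums over integer ranges

  toℕ⁺-nonpos : ∀ {x} → x ≤ 0ℤ → toℕ⁺ x ≡ 0
  toℕ⁺-nonpos {+ zero}    _          = ≡.refl
  toℕ⁺-nonpos { -[1+ _ ]} _          = ≡.refl
  toℕ⁺-nonpos {+ suc _}   (ℤ.+≤+ ())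

  <toℕ⁺⇒< : ∀ {i x} → i ℕ.< toℕ⁺ x → + i < x
  <toℕ⁺⇒< {x = + _} i<x = ℤ.+<+ i<x

  i<1+toℕ⁺i : ∀ i → i < + suc (toℕ⁺ i)
  i<1+toℕ⁺i (+ n)    = ℤ.+<+ (ℕ.n<1+n n)
  i<1+toℕ⁺i -[1+ _ ] = ℤ.-<+

  sumN≡sum : ∀ n (f : ℕ → K) → sumN n f ≡ sum (λ i → f (toℕ {n} i))
  sumN≡sum zero    f = ≡.refl
  sumN≡sum (suc n) f = ≡.cong (_+_ (f 0)) (sumN≡sum n (f ∘ suc))

  sumN-cong : ∀ n {f g : ℕ → K} → (∀ i → i ℕ.< n → f i ≈ g i) → sumN n f ≈ sumN n g
  sumN-cong zero    f≈g = refl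
  sumN-cong (suc n) f≈g = +-cong (f≈g 0 ℕ.z<s) (sumN-cong n (λ i i<n → f≈g (suc i) (ℕ.s<s i<n)))

  sumN-*ˡ : ∀ n x (f : ℕ → K) → x * sumN n f ≈ sumN n (λ i → x * f i)
  sumN-*ˡ n x f rewrite sumN≡sum n f | sumN≡sum n (λ i → x * f i) = *-distribˡ-sum {n} x _

  sumN-*ʳ : ∀ n x (f : ℕ → K) → sumN n f * x ≈ sumN n (λ i → f i * x)
  sumN-*ʳ n x f rewrite sumN≡sum n f | sumN≡sum n (λ i → f i * x) = *-distribʳ-sum {n} x _

  sumN-comm : ∀ m n (G : ℕ → ℕ → K) →
              sumN m (λ i → sumN n (G i)) ≈ sumN n (λ j → sumN m (λ i → G i j))
  sumN-comm m n G = begin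
    sumN m (λ i → sumN n (G i))
      ≡⟨ double-sum m n G ⟩
    sum (λ i → sum (λ j → G (toℕ {m} i) (toℕ {n} j)))
      ≈⟨ ∑-comm {m} {n} (λ i j → G (toℕ i) (toℕ j)) ⟩
    sum (λ j → sum (λ i → G (toℕ {m} i) (toℕ {n} j)))
      ≡⟨ double-sum n m (λ j i → G i j) ⟨
    sumN n (λ j → sumN m (λ i → G i j))
      ∎
    where
    double-sum : ∀ m n (G : ℕ → ℕ → K) →
                 sumN m (λ i → sumN n (G i)) ≡ sum (λ i → sum (λ j → G (toℕ {m} i) (toℕ {n} j)))
    double-sum m n G = ≡.trans (sumN≡sum m _) (sum-cong-≗ {m} (λ i → sumN≡sum n (G (toℕ i))))

  sumN-snoc : ∀ n (f : ℕ → K) → sumN (suc n) f ≈ sumN n f + f n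
  sumN-snoc zero    f = trans (+-identityʳ _) (sym (+-identityˡ _))
  sumN-snoc (suc n) f = trans (+-congˡ (sumN-snoc n (f ∘ suc))) (sym (+-assoc _ _ _))

  sumZ≡sumN : ∀ lo hi {n} (f : ℤ → K) → hi ℤ.- lo ℤ.+ 1ℤ ≡ + n →
              sumZ lo hi f ≡ sumN n (λ i → f (lo ℤ.+ + i))
  sumZ≡sumN lo hi f count rewrite count = ≡.refl

  -- The ring solver only abstracts variables, so identities that are needed at
  -- an index + d are proved for an arbitrary x and then instantiated.
  sumZ-interval : ∀ lo d (f : ℤ → K) →
                  sumZ lo (lo ℤ.+ + d) f ≡ sumN (suc d) (λ i → f (lo ℤ.+ + i))
  sumZ-interval lo d f = sumZ≡sumN lo (lo ℤ.+ + d) f (count (+ d))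
    where
    count : ∀ x → (lo ℤ.+ x) ℤ.- lo ℤ.+ 1ℤ ≡ 1ℤ ℤ.+ x
    count x = solve (lo ∷ x ∷ [])

  sumZ-empty : ∀ {lo hi} (f : ℤ → K) → hi < lo → sumZ lo hi f ≈ 0#
  sumZ-empty {lo} {hi} f hi<lo = reflexive (≡.cong (λ n → sumN n _) (toℕ⁺-nonpos count≤0))
    where
    count≤0 : hi ℤ.- lo ℤ.+ 1ℤ ≤ 0ℤ
    count≤0 = ≤-translate (<⇒1+≤ hi<lo) (solve (hi ∷ lo ∷ []))

  sumZ-cong : ∀ lo hi {f g : ℤ → K} → (∀ i → lo ≤ i → i ≤ hi → f i ≈ g i) →
              sumZ lo hi f ≈ sumZ lo hi g
  sumZ-cong lo hi f≈g =
    sumN-cong _ (λ i i<n → f≈g _ (ℤ.i≤i+j lo (+ i)) (in-range (<toℕ⁺⇒< i<n)))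
    where
    in-range : ∀ {j} → j < hi ℤ.- lo ℤ.+ 1ℤ → lo ℤ.+ j ≤ hi
    in-range {j} j<n = ≤-translate (<⇒1+≤ j<n) (solve (hi ∷ lo ∷ j ∷ []))

  sumZ-*ˡ : ∀ lo hi x (f : ℤ → K) → x * sumZ lo hi f ≈ sumZ lo hi (λ i → x * f i)
  sumZ-*ˡ lo hi x f = sumN-*ˡ (toℕ⁺ (hi ℤ.- lo ℤ.+ 1ℤ)) x _

  sumZ-*ʳ : ∀ lo hi x (f : ℤ → K) → sumZ lo hi f * x ≈ sumZ lo hi (λ i → f i * x)
  sumZ-*ʳ lo hi x f = sumN-*ʳ (toℕ⁺ (hi ℤ.- lo ℤ.+ 1ℤ)) x _

  sumZ-comm : ∀ lo₁ hi₁ lo₂ hi₂ (G : ℤ → ℤ → K) →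
              sumZ lo₁ hi₁ (λ i → sumZ lo₂ hi₂ (G i)) ≈
              sumZ lo₂ hi₂ (λ j → sumZ lo₁ hi₁ (λ i → G i j))
  sumZ-comm lo₁ hi₁ lo₂ hi₂ G =
    sumN-comm (toℕ⁺ (hi₁ ℤ.- lo₁ ℤ.+ 1ℤ)) (toℕ⁺ (hi₂ ℤ.- lo₂ ℤ.+ 1ℤ)) _

  sumZ-peelˡ : ∀ {lo hi} (f : ℤ → K) → lo ≤ hi → sumZ lo hi f ≈ f lo + sumZ (lo ℤ.+ 1ℤ) hi f
  sumZ-peelˡ {lo} f lo≤hi with i≤j⇒∃[d]i+d≡j lo≤hi
  ... | d , ≡.refl = begin
    sumZ lo (lo ℤ.+ + d) f
      ≡⟨ sumZ-interval lo d f ⟩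
    f (lo ℤ.+ + 0) + sumN d (λ i → f (lo ℤ.+ + suc i))
      ≈⟨ +-cong (reflexive (≡.cong f (ℤ.+-identityʳ lo)))
                (sumN-cong d (λ i _ → reflexive (≡.cong f (shift (+ i))))) ⟩
    f lo + sumN d (λ i → f ((lo ℤ.+ 1ℤ) ℤ.+ + i))
      ≡⟨ ≡.cong (_+_ (f lo)) (sumZ≡sumN (lo ℤ.+ 1ℤ) (lo ℤ.+ + d) f (count (+ d))) ⟨
    f lo + sumZ (lo ℤ.+ 1ℤ) (lo ℤ.+ + d) f
      ∎
    where
    shift : ∀ x → lo ℤ.+ (1ℤ ℤ.+ x) ≡ (lo ℤ.+ 1ℤ) ℤ.+ x
    shift x = solve (lo ∷ x ∷ [])
    count : ∀ x → (lo ℤ.+ x) ℤ.- (lo ℤ.+ 1ℤ) ℤ.+ 1ℤ ≡ x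
    count x = solve (lo ∷ x ∷ [])

  sumZ-peelʳ : ∀ {lo hi} (f : ℤ → K) → lo ≤ hi → sumZ lo hi f ≈ sumZ lo (hi ℤ.- 1ℤ) f + f hi
  sumZ-peelʳ {lo} f lo≤hi with i≤j⇒∃[d]i+d≡j lo≤hi
  ... | d , ≡.refl = begin
    sumZ lo (lo ℤ.+ + d) f
      ≡⟨ sumZ-interval lo d f ⟩
    sumN (suc d) (λ i → f (lo ℤ.+ + i))
      ≈⟨ sumN-snoc d _ ⟩
    sumN d (λ i → f (lo ℤ.+ + i)) + f (lo ℤ.+ + d)
      ≡⟨ ≡.cong (_+ f (lo ℤ.+ + d)) (sumZ≡sumN lo (lo ℤ.+ + d ℤ.- 1ℤ) f (count (+ d))) ⟨
    sumZ lo (lo ℤ.+ + d ℤ.- 1ℤ) f + f (lo ℤ.+ + d)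
      ∎
    where
    count : ∀ x → (lo ℤ.+ x ℤ.- 1ℤ) ℤ.- lo ℤ.+ 1ℤ ≡ x
    count x = solve (lo ∷ x ∷ [])

  sumZ-dropˡ : ∀ lo hi (f : ℤ → K) → f lo ≈ 0# → sumZ lo hi f ≈ sumZ (lo ℤ.+ 1ℤ) hi f
  sumZ-dropˡ lo hi f f-lo≈0 with lo ℤ.≤? hi
  ... | yes lo≤hi = trans (sumZ-peelˡ f lo≤hi) (trans (+-congʳ f-lo≈0) (+-identityˡ _))
  ... | no  lo≰hi =
    trans (sumZ-empty f hi<lo) (sym (sumZ-empty f (ℤ.<-≤-trans hi<lo (ℤ.i≤i+j lo 1ℤ))))
    where
    hi<lo : hi < lo
    hi<lo = ℤ.≰⇒> lo≰hi

  sumZ-dropʳ : ∀ lo hi (f : ℤ → K) → f hi ≈ 0# → sumZ lo hi f ≈ sumZ lo (hi ℤ.- 1ℤ) f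
  sumZ-dropʳ lo hi f f-hi≈0 with lo ℤ.≤? hi
  ... | yes lo≤hi = trans (sumZ-peelʳ f lo≤hi) (trans (+-congˡ f-hi≈0) (+-identityʳ _))
  ... | no  lo≰hi =
    trans (sumZ-empty f hi<lo) (sym (sumZ-empty f (ℤ.≤-<-trans (ℤ.i-j≤i hi 1ℤ) hi<lo)))
    where
    hi<lo : hi < lo
    hi<lo = ℤ.≰⇒> lo≰hi

  sumZ-trimˡ : ∀ lo hi d (f : ℤ → K) → (∀ i → i < lo ℤ.+ + d → f i ≈ 0#) →
               sumZ lo hi f ≈ sumZ (lo ℤ.+ + d) hi f
  sumZ-trimˡ lo hi zero    f f≈0 =
    reflexive (≡.cong (λ l → sumZ l hi f) (≡.sym (ℤ.+-identityʳ lo)))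
  sumZ-trimˡ lo hi (suc d) f f≈0 = begin
    sumZ lo hi f                   ≈⟨ sumZ-trimˡ lo hi d f (λ i i<l → f≈0 i (ℤ.<-trans i<l step)) ⟩
    sumZ (lo ℤ.+ + d) hi f         ≈⟨ sumZ-dropˡ (lo ℤ.+ + d) hi f (f≈0 _ step) ⟩
    sumZ (lo ℤ.+ + d ℤ.+ 1ℤ) hi f  ≡⟨ ≡.cong (λ l → sumZ l hi f) (next (+ d)) ⟩
    sumZ (lo ℤ.+ + suc d) hi f     ∎
    where
    step : lo ℤ.+ + d < lo ℤ.+ + suc d
    step = ℤ.+-monoʳ-< lo (ℤ.+<+ (ℕ.n<1+n d))
    next : ∀ x → lo ℤ.+ x ℤ.+ 1ℤ ≡ lo ℤ.+ (1ℤ ℤ.+ x)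
    next x = solve (lo ∷ x ∷ [])

  sumZ-trimʳ : ∀ lo H d (f : ℤ → K) → (∀ i → H < i → f i ≈ 0#) →
               sumZ lo (H ℤ.+ + d) f ≈ sumZ lo H f
  sumZ-trimʳ lo H zero    f f≈0 = reflexive (≡.cong (λ h → sumZ lo h f) (ℤ.+-identityʳ H))
  sumZ-trimʳ lo H (suc d) f f≈0 = begin
    sumZ lo (H ℤ.+ + suc d) f         ≈⟨ sumZ-dropʳ lo _ f (f≈0 _ H<H+1+d) ⟩
    sumZ lo (H ℤ.+ + suc d ℤ.- 1ℤ) f  ≡⟨ ≡.cong (λ h → sumZ lo h f) (previous (+ d)) ⟩
    sumZ lo (H ℤ.+ + d) f             ≈⟨ sumZ-trimʳ lo H d f f≈0 ⟩
    sumZ lo H f                       ∎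
    where
    H<H+1+d : H < H ℤ.+ + suc d
    H<H+1+d = ℤ.≤-<-trans (ℤ.i≤i+j H (+ d)) (ℤ.+-monoʳ-< H (ℤ.+<+ (ℕ.n<1+n d)))
    previous : ∀ x → H ℤ.+ (1ℤ ℤ.+ x) ℤ.- 1ℤ ≡ H ℤ.+ x
    previous x = solve (H ∷ x ∷ [])

  sumZ-support : ∀ {lo hi L H} (f : ℤ → K) →
                 (∀ i → i < L → f i ≈ 0#) → (∀ i → H < i → f i ≈ 0#) →
                 lo ≤ L → H ≤ hi → sumZ lo hi f ≈ sumZ L H f
  sumZ-support {lo} {L = L} {H} f below above lo≤L H≤hi
    with i≤j⇒∃[d]i+d≡j lo≤L | i≤j⇒∃[d]i+d≡j H≤hi
  ... | d , ≡.refl | e , ≡.refl =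
    trans (sumZ-trimˡ lo (H ℤ.+ + e) d f below) (sumZ-trimʳ L H e f above)

  sumZ-window : ∀ {lo₁ hi₁ lo₂ hi₂ L H} (f : ℤ → K) →
                (∀ i → i < L → f i ≈ 0#) → (∀ i → H < i → f i ≈ 0#) →
                lo₁ ≤ L → H ≤ hi₁ → lo₂ ≤ L → H ≤ hi₂ →
                sumZ lo₁ hi₁ f ≈ sumZ lo₂ hi₂ f
  sumZ-window f below above lo₁≤L H≤hi₁ lo₂≤L H≤hi₂ =
    trans (sumZ-support f below above lo₁≤L H≤hi₁)
          (sym (sumZ-support f below above lo₂≤L H≤hi₂))

  sumZ-point : ∀ {lo hi k} (f : ℤ → K) → (∀ i → i ≢ k → f i ≈ 0#) → lo ≤ k → k ≤ hi →
               sumZ lo hi f ≈ f k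
  sumZ-point {k = k} f f≈0 lo≤k k≤hi = begin
    _                   ≈⟨ sumZ-support f (λ i i<k → f≈0 i (ℤ.<⇒≢ i<k))
                                          (λ i k<i → f≈0 i (≡.≢-sym (ℤ.<⇒≢ k<i))) lo≤k k≤hi ⟩
    sumZ k k f          ≡⟨ sumZ≡sumN k k f (solve (k ∷ [])) ⟩
    f (k ℤ.+ + 0) + 0#  ≈⟨ +-identityʳ _ ⟩
    f (k ℤ.+ + 0)       ≡⟨ ≡.cong f (ℤ.+-identityʳ k) ⟩
    f k                 ∎

  sumZ-shift : ∀ lo hi c (f : ℤ → K) →
               sumZ lo hi f ≈ sumZ (lo ℤ.- c) (hi ℤ.- c) (λ j → f (j ℤ.+ c))
  sumZ-shift lo hi c f = begin
    sumN n (λ i → f (lo ℤ.+ + i))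
      ≈⟨ sumN-cong n (λ i _ → reflexive (≡.cong f (shifted (+ i)))) ⟩
    sumN n (λ i → f ((lo ℤ.- c) ℤ.+ + i ℤ.+ c))
      ≡⟨ ≡.cong (λ m → sumN (toℕ⁺ m) (λ i → f ((lo ℤ.- c) ℤ.+ + i ℤ.+ c))) count ⟩
    sumN (toℕ⁺ ((hi ℤ.- c) ℤ.- (lo ℤ.- c) ℤ.+ 1ℤ)) (λ i → f ((lo ℤ.- c) ℤ.+ + i ℤ.+ c))
      ∎
    where
    n : ℕ
    n = toℕ⁺ (hi ℤ.- lo ℤ.+ 1ℤ)
    shifted : ∀ x → lo ℤ.+ x ≡ (lo ℤ.- c) ℤ.+ x ℤ.+ c
    shifted x = solve (lo ∷ c ∷ x ∷ [])
    count : hi ℤ.- lo ℤ.+ 1ℤ ≡ (hi ℤ.- c) ℤ.- (lo ℤ.- c) ℤ.+ 1ℤ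
    count = solve (hi ∷ lo ∷ c ∷ [])

  -- Laurent series in D

  ≈L-setoid : Setoid c ℓ
  ≈L-setoid = record
    { Carrier       = LS
    ; _≈_           = _≈L_
    ; isEquivalence = record
      { refl  = λ _ → refl
      ; sym   = λ s≈t n → sym (s≈t n)
      ; trans = λ s≈t t≈u n → trans (s≈t n) (t≈u n)
      }
    }

  module ≈L = Setoid ≈L-setoid

  VanishesBelow : LS → ℤ → Set ℓ
  VanishesBelow s A = ∀ i → i < A → coeff s i ≈ 0#

  coeff-below-ord : ∀ s → VanishesBelow s (LS.ord s)
  coeff-below-ord s i i<ord with i ℤ.<? LS.ord s
  ... | yes _     = refl
  ... | no  i≮ord = ⊥-elim (i≮ord i<ord)

  vanishesBelow-cong : ∀ {s t A} → s ≈L t → VanishesBelow s A → VanishesBelow t A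
  vanishesBelow-cong s≈t s≈0 i i<A = trans (sym (s≈t i)) (s≈0 i i<A)

  vanishesBelow-⊔-ord : ∀ {s A} → VanishesBelow s A → VanishesBelow s (A ⊔ LS.ord s)
  vanishesBelow-⊔-ord {s} {A} s≈0 i i<A⊔ord with ℤ.⊔-sel A (LS.ord s)
  ... | inj₁ A⊔ord≡A   = s≈0 i (≡.subst (i <_) A⊔ord≡A i<A⊔ord)
  ... | inj₂ A⊔ord≡ord = coeff-below-ord s i (≡.subst (i <_) A⊔ord≡ord i<A⊔ord)

  coeff-mulL-ord : ∀ s t n → coeff (mulL s t) n ≈
                   sumZ (LS.ord s) (n ℤ.- LS.ord t) (λ i → coeff s i * coeff t (n ℤ.- i))
  coeff-mulL-ord s t n with n ℤ.<? LS.ord s ℤ.+ LS.ord t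
  ... | yes n<ord = sym (sumZ-empty (λ i → coeff s i * coeff t (n ℤ.- i)) (i<j+k⇒i-k<j n<ord))
  ... | no  _     = refl

  coeff-mulL : ∀ {s t A B lo hi} n → VanishesBelow s A → VanishesBelow t B →
               lo ≤ A → n ℤ.- B ≤ hi →
               coeff (mulL s t) n ≈ sumZ lo hi (λ i → coeff s i * coeff t (n ℤ.- i))
  coeff-mulL {s} {t} {A} {B} n s≈0 t≈0 lo≤A n-B≤hi =
    trans (coeff-mulL-ord s t n)
          (sumZ-window _ below above
             (ℤ.i≤j⊔i A (LS.ord s)) (i≤j⇒k-j≤k-i n (ℤ.i≤j⊔i B (LS.ord t)))
             (ℤ.≤-trans lo≤A (ℤ.i≤i⊔j A (LS.ord s)))
             (ℤ.≤-trans (i≤j⇒k-j≤k-i n (ℤ.i≤i⊔j B (LS.ord t))) n-B≤hi))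
    where
    below : ∀ i → i < A ⊔ LS.ord s → coeff s i * coeff t (n ℤ.- i) ≈ 0#
    below i i<A′ = x≈0⇒x*y≈0 (vanishesBelow-⊔-ord s≈0 i i<A′)
    above : ∀ i → n ℤ.- (B ⊔ LS.ord t) < i → coeff s i * coeff t (n ℤ.- i) ≈ 0#
    above i n-B′<i = y≈0⇒x*y≈0 (vanishesBelow-⊔-ord t≈0 (n ℤ.- i) n-i<B′)
      where
      n-i<B′ : n ℤ.- i < B ⊔ LS.ord t
      n-i<B′ = i-j<k⇒i-k<j n (B ⊔ LS.ord t) i n-B′<i

  mulL-vanishesBelow : ∀ {s t A B} → VanishesBelow s A → VanishesBelow t B →
                       VanishesBelow (mulL s t) (A ℤ.+ B)
  mulL-vanishesBelow {s} {t} s≈0 t≈0 n n<A+B =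
    trans (coeff-mulL n s≈0 t≈0 ℤ.≤-refl ℤ.≤-refl)
          (sumZ-empty (λ i → coeff s i * coeff t (n ℤ.- i)) (i<j+k⇒i-k<j n<A+B))

  mulL-cong : ∀ {s s′ t t′} → s ≈L s′ → t ≈L t′ → mulL s t ≈L mulL s′ t′
  mulL-cong {s} {s′} {t} {t′} s≈s′ t≈t′ n = begin
    coeff (mulL s t) n
      ≈⟨ coeff-mulL n (coeff-below-ord s) (coeff-below-ord t) ℤ.≤-refl ℤ.≤-refl ⟩
    sumZ (LS.ord s) (n ℤ.- LS.ord t) (λ i → coeff s i * coeff t (n ℤ.- i))
      ≈⟨ sumZ-cong (LS.ord s) (n ℤ.- LS.ord t) (λ i _ _ → *-cong (s≈s′ i) (t≈t′ (n ℤ.- i))) ⟩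
    sumZ (LS.ord s) (n ℤ.- LS.ord t) (λ i → coeff s′ i * coeff t′ (n ℤ.- i))
      ≈⟨ coeff-mulL n (vanishesBelow-cong s≈s′ (coeff-below-ord s))
                      (vanishesBelow-cong t≈t′ (coeff-below-ord t)) ℤ.≤-refl ℤ.≤-refl ⟨
    coeff (mulL s′ t′) n
      ∎

  -- oneL and DL are, definitionally, monomial 0ℤ and monomial 1ℤ.
  monomial : ℤ → LS
  monomial k = record { ord = k ; raw = λ n → if does (n ℤ.≟ k) then 1# else 0# }

  IsMonomial : LS → ℤ → Set ℓ
  IsMonomial e k = coeff e k ≈ 1# × (∀ i → i ≢ k → coeff e i ≈ 0#)

  monomial-isMonomial : ∀ k → IsMonomial (monomial k) k
  monomial-isMonomial k = coeff-k , coeff-≢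
    where
    coeff-k : coeff (monomial k) k ≈ 1#
    coeff-k with k ℤ.<? k | k ℤ.≟ k
    ... | yes k<k | _       = ⊥-elim (ℤ.<-irrefl ≡.refl k<k)
    ... | no  _   | yes _   = refl
    ... | no  _   | no  k≢k = ⊥-elim (k≢k ≡.refl)
    coeff-≢ : ∀ i → i ≢ k → coeff (monomial k) i ≈ 0#
    coeff-≢ i i≢k with i ℤ.<? k | i ℤ.≟ k
    ... | yes _ | _       = refl
    ... | no  _ | yes i≡k = ⊥-elim (i≢k i≡k)
    ... | no  _ | no  _   = refl

  coeff-mulL-monomial : ∀ {e k} → IsMonomial e k → ∀ s n → coeff (mulL e s) n ≈ coeff s (n ℤ.- k)
  coeff-mulL-monomial {e} {k} (e-k≈1 , e-≢≈0) s n =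
    trans (coeff-mulL n e≈0 (coeff-below-ord s) ℤ.≤-refl ℤ.≤-refl) sum≈
    where
    e≈0 : VanishesBelow e k
    e≈0 i i<k = e-≢≈0 i (ℤ.<⇒≢ i<k)
    term : ℤ → K
    term i = coeff e i * coeff s (n ℤ.- i)
    sum≈ : sumZ k (n ℤ.- LS.ord s) term ≈ coeff s (n ℤ.- k)
    sum≈ with k ℤ.≤? n ℤ.- LS.ord s
    ... | yes k≤ = trans (sumZ-point term (λ i i≢k → x≈0⇒x*y≈0 (e-≢≈0 i i≢k))
                                     ℤ.≤-refl k≤)
                         (trans (*-congʳ e-k≈1) (*-identityˡ _))
    ... | no  k≰ = trans (sumZ-empty term (ℤ.≰⇒> k≰))
                         (sym (coeff-below-ord s (n ℤ.- k) (i-j<k⇒i-k<j n (LS.ord s) k (ℤ.≰⇒> k≰))))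

  mulL-identityˡ : ∀ s → mulL oneL s ≈L s
  mulL-identityˡ s n = trans (coeff-mulL-monomial (monomial-isMonomial 0ℤ) s n)
                             (reflexive (≡.cong (coeff s) (ℤ.+-identityʳ n)))

  coeff-mulL-shift : ∀ {t u B C lo hi} c n → VanishesBelow t B → VanishesBelow u C →
                     lo ≤ B ℤ.+ c → n ℤ.- C ≤ hi →
                     sumZ lo hi (λ k → coeff t (k ℤ.- c) * coeff u (n ℤ.- k)) ≈
                     coeff (mulL t u) (n ℤ.- c)
  coeff-mulL-shift {t} {u} {B} {C} {lo} {hi} c n t≈0 u≈0 lo≤B+c n-C≤hi = begin
    sumZ lo hi (λ k → coeff t (k ℤ.- c) * coeff u (n ℤ.- k))
      ≈⟨ sumZ-shift lo hi c (λ k → coeff t (k ℤ.- c) * coeff u (n ℤ.- k)) ⟩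
    sumZ (lo ℤ.- c) (hi ℤ.- c) (λ j → coeff t (j ℤ.+ c ℤ.- c) * coeff u (n ℤ.- (j ℤ.+ c)))
      ≈⟨ sumZ-cong (lo ℤ.- c) (hi ℤ.- c) (λ j _ _ → reflexive (reindex j)) ⟩
    sumZ (lo ℤ.- c) (hi ℤ.- c) (λ j → coeff t j * coeff u (n ℤ.- c ℤ.- j))
      ≈⟨ coeff-mulL {lo = lo ℤ.- c} {hi ℤ.- c} (n ℤ.- c) t≈0 u≈0
           (≤-translate lo≤B+c (solve (B ∷ lo ∷ c ∷ [])))
           (≤-translate n-C≤hi (solve (hi ∷ c ∷ n ∷ C ∷ []))) ⟨
    coeff (mulL t u) (n ℤ.- c)
      ∎
    where
    reindex : ∀ j → coeff t (j ℤ.+ c ℤ.- c) * coeff u (n ℤ.- (j ℤ.+ c)) ≡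
                    coeff t j * coeff u (n ℤ.- c ℤ.- j)
    reindex j =
      ≡.cong₂ (λ a b → coeff t a * coeff u b) (solve (j ∷ c ∷ [])) (solve (n ∷ j ∷ c ∷ []))

  -- Generalised over vanishing orders A, B, C so that they are variables for the
  -- ring solver (LS.ord s is not).
  mulL-assoc-from : ∀ {s t u A B C} → VanishesBelow s A → VanishesBelow t B → VanishesBelow u C →
                    mulL (mulL s t) u ≈L mulL s (mulL t u)
  mulL-assoc-from {s} {t} {u} {A} {B} {C} s≈0 t≈0 u≈0 n = begin
    coeff (mulL (mulL s t) u) n
      ≈⟨ coeff-mulL n (mulL-vanishesBelow s≈0 t≈0) u≈0 ℤ.≤-refl ℤ.≤-refl ⟩
    sumZ (A ℤ.+ B) (n ℤ.- C) (λ k → coeff (mulL s t) k * cu (n ℤ.- k))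
      ≈⟨ sumZ-cong (A ℤ.+ B) (n ℤ.- C) (λ k _ k≤n-C → *-congʳ {cu (n ℤ.- k)} (coeff-st k k≤n-C)) ⟩
    sumZ (A ℤ.+ B) (n ℤ.- C) (λ k → sumZ A (n ℤ.- B ℤ.- C) (st k) * cu (n ℤ.- k))
      ≈⟨ sumZ-cong (A ℤ.+ B) (n ℤ.- C) (λ k _ _ → sumZ-*ʳ A (n ℤ.- B ℤ.- C) (cu (n ℤ.- k)) (st k)) ⟩
    sumZ (A ℤ.+ B) (n ℤ.- C) (λ k → sumZ A (n ℤ.- B ℤ.- C) (λ i → term i k))
      ≈⟨ sumZ-comm (A ℤ.+ B) (n ℤ.- C) A (n ℤ.- B ℤ.- C) (λ k i → term i k) ⟩
    sumZ A (n ℤ.- B ℤ.- C) (λ i → sumZ (A ℤ.+ B) (n ℤ.- C) (term i))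
      ≈⟨ sumZ-cong A (n ℤ.- B ℤ.- C) (λ i A≤i _ → inner i A≤i) ⟩
    sumZ A (n ℤ.- B ℤ.- C) (λ i → cs i * coeff (mulL t u) (n ℤ.- i))
      ≈⟨ coeff-mulL n s≈0 (mulL-vanishesBelow t≈0 u≈0) ℤ.≤-refl
                    (ℤ.≤-reflexive n-[B+C]≡n-B-C) ⟨
    coeff (mulL s (mulL t u)) n
      ∎
    where
    cs ct cu : ℤ → K
    cs = coeff s
    ct = coeff t
    cu = coeff u
    st : ℤ → ℤ → K
    st k i = cs i * ct (k ℤ.- i)
    term : ℤ → ℤ → K
    term i k = cs i * ct (k ℤ.- i) * cu (n ℤ.- k)
    n-[B+C]≡n-B-C : n ℤ.- (B ℤ.+ C) ≡ n ℤ.- B ℤ.- C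
    n-[B+C]≡n-B-C = solve (n ∷ B ∷ C ∷ [])
    coeff-st : ∀ k → k ≤ n ℤ.- C → coeff (mulL s t) k ≈ sumZ A (n ℤ.- B ℤ.- C) (st k)
    coeff-st k k≤n-C = coeff-mulL {hi = n ℤ.- B ℤ.- C} k s≈0 t≈0 ℤ.≤-refl
                                  (≤-translate k≤n-C (solve (k ∷ n ∷ B ∷ C ∷ [])))
    inner : ∀ i → A ≤ i → sumZ (A ℤ.+ B) (n ℤ.- C) (term i) ≈ cs i * coeff (mulL t u) (n ℤ.- i)
    inner i A≤i = begin
      sumZ (A ℤ.+ B) (n ℤ.- C) (term i)
        ≈⟨ sumZ-cong (A ℤ.+ B) (n ℤ.- C) (λ k _ _ → *-assoc (cs i) (ct (k ℤ.- i)) (cu (n ℤ.- k))) ⟩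
      sumZ (A ℤ.+ B) (n ℤ.- C) (λ k → cs i * (ct (k ℤ.- i) * cu (n ℤ.- k)))
        ≈⟨ sumZ-*ˡ (A ℤ.+ B) (n ℤ.- C) (cs i) (λ k → ct (k ℤ.- i) * cu (n ℤ.- k)) ⟨
      cs i * sumZ (A ℤ.+ B) (n ℤ.- C) (λ k → ct (k ℤ.- i) * cu (n ℤ.- k))
        ≈⟨ *-congˡ (coeff-mulL-shift {lo = A ℤ.+ B} {n ℤ.- C} i n t≈0 u≈0 A+B≤B+i ℤ.≤-refl) ⟩
      cs i * coeff (mulL t u) (n ℤ.- i)
        ∎
      where
      A+B≤B+i : A ℤ.+ B ≤ B ℤ.+ i
      A+B≤B+i = ≤-translate A≤i (solve (A ∷ B ∷ i ∷ []))

  mulL-assoc : ∀ s t u → mulL (mulL s t) u ≈L mulL s (mulL t u)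
  mulL-assoc s t u = mulL-assoc-from (coeff-below-ord s) (coeff-below-ord t) (coeff-below-ord u)

  -- Integer powers of a delta operator

  module DeltaPowers (h : LS) (δh : IsDelta h) where

    h⁻¹ : LS
    h⁻¹ = invDelta h

    powN-vanishesBelow : ∀ n → VanishesBelow (powN h n) (+ n)
    powN-vanishesBelow zero    = coeff-below-ord oneL
    powN-vanishesBelow (suc n) = mulL-vanishesBelow (proj₁ δh) (powN-vanishesBelow n)

    powN⁻¹-vanishesBelow : ∀ n → VanishesBelow (powN h⁻¹ n) (ℤ.- + n)
    powN⁻¹-vanishesBelow zero    = coeff-below-ord oneL
    powN⁻¹-vanishesBelow (suc n) =
      ≡.subst (VanishesBelow (powN h⁻¹ (suc n))) (≡.sym (ℤ.neg-distrib-+ 1ℤ (+ n)))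
              (mulL-vanishesBelow (coeff-below-ord h⁻¹) (powN⁻¹-vanishesBelow n))

    powZ-vanishesBelow : ∀ a → VanishesBelow (powZ h a) a
    powZ-vanishesBelow (+ n)    = powN-vanishesBelow n
    powZ-vanishesBelow -[1+ n ] = powN⁻¹-vanishesBelow (suc n)

    private
      u : ℕ → K
      u i = coeff h (+ suc i)

    psInv-suc : ∀ n → psInv u (suc n) ≡
                - (u 0 ⁻¹ * sumN (suc n) (λ i → u (suc i) * invStage u n (n ℕ.∸ i)))
    psInv-suc n = if-false (suc n ℕ.≤? n) (ℕ.<-irrefl ≡.refl)

    invStage-stable : ∀ n j → j ℕ.≤ n → invStage u n j ≡ psInv u j
    invStage-stable zero    .zero ℕ.z≤n = ≡.refl
    invStage-stable (suc n) j     j≤1+n with j ℕ.≤? n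
    ... | yes j≤n = ≡.trans (if-true (j ℕ.≤? n) j≤n) (invStage-stable n j j≤n)
    ... | no  j≰n = ≡.trans (if-false (j ℕ.≤? n) j≰n)
                            (≡.sym (≡.trans (≡.cong (psInv u) j≡1+n) (psInv-suc n)))
      where
      j≡1+n : j ≡ suc n
      j≡1+n = ℕ.≤-antisym j≤1+n (ℕ.≰⇒> j≰n)

    u*psInv≈1 : ∀ N → sumN (suc N) (λ k → u k * psInv u (N ℕ.∸ k)) ≈ coeff oneL (+ N)
    u*psInv≈1 zero    =
      trans (+-identityʳ _) (trans (⁻¹-inverse _ (proj₂ δh)) (sym (proj₁ (monomial-isMonomial 0ℤ))))
    u*psInv≈1 (suc M) = begin
      u 0 * psInv u (suc M) + S    ≡⟨ ≡.cong (λ v → u 0 * v + S) (psInv-suc M) ⟩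
      u 0 * - (u 0 ⁻¹ * S′) + S    ≈⟨ +-congʳ (*-congˡ (-‿cong (*-congˡ S′≈S))) ⟩
      u 0 * - (u 0 ⁻¹ * S) + S     ≈⟨ +-congʳ (-‿distribʳ-* _ _) ⟨
      - (u 0 * (u 0 ⁻¹ * S)) + S   ≈⟨ +-congʳ (-‿cong u0*[u0⁻¹*S]≈S) ⟩
      - S + S                      ≈⟨ -‿inverseˡ S ⟩
      0#                           ≈⟨ proj₂ (monomial-isMonomial 0ℤ) (+ suc M) (λ ()) ⟨
      coeff oneL (+ suc M)         ∎
      where
      S S′ : K
      S  = sumN (suc M) (λ k → u (suc k) * psInv u (M ℕ.∸ k))
      S′ = sumN (suc M) (λ k → u (suc k) * invStage u M (M ℕ.∸ k))
      S′≈S : S′ ≈ S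
      S′≈S = sumN-cong (suc M) (λ k _ →
        *-congˡ {u (suc k)} (reflexive (invStage-stable M (M ℕ.∸ k) (ℕ.m∸n≤m M k))))
      u0*[u0⁻¹*S]≈S : u 0 * (u 0 ⁻¹ * S) ≈ S
      u0*[u0⁻¹*S]≈S = trans (sym (*-assoc _ _ _))
                            (trans (*-congʳ (⁻¹-inverse _ (proj₂ δh))) (*-identityˡ S))

    coeff-h⁻¹ : ∀ j → coeff h⁻¹ (+ j ℤ.- 1ℤ) ≈ psInv u j
    coeff-h⁻¹ j = reflexive (≡.trans (if-false (+ j ℤ.- 1ℤ ℤ.<? -1ℤ) (ℤ.≤⇒≯ -1≤j-1))
                                     (≡.cong (psInv u ∘ toℕ⁺) j-1+1≡j))
      where
      -1≤j-1 : -1ℤ ≤ + j ℤ.- 1ℤ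
      -1≤j-1 = ℤ.+-monoˡ-≤ -1ℤ (ℤ.+≤+ (ℕ.z≤n {j}))
      j-1+1≡j : + j ℤ.- 1ℤ ℤ.+ 1ℤ ≡ + j
      j-1+1≡j = ≡.trans (ℤ.+-assoc (+ j) -1ℤ 1ℤ) (ℤ.+-identityʳ (+ j))

    h*h⁻¹≈1 : mulL h h⁻¹ ≈L oneL
    h*h⁻¹≈1 -[1+ N ] = begin
      coeff (mulL h h⁻¹) -[1+ N ]
        ≈⟨ coeff-mulL -[1+ N ] (proj₁ δh) (coeff-below-ord h⁻¹) ℤ.≤-refl ℤ.≤-refl ⟩
      sumZ 1ℤ (-[1+ N ] ℤ.- -1ℤ) term
        ≈⟨ sumZ-empty term (i<j+k⇒i-k<j { -[1+ N ]} {1ℤ} { -1ℤ} ℤ.-<+) ⟩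
      0#
        ≈⟨ proj₂ (monomial-isMonomial 0ℤ) -[1+ N ] (λ ()) ⟨
      coeff oneL -[1+ N ]
        ∎
      where
      term : ℤ → K
      term i = coeff h i * coeff h⁻¹ (-[1+ N ] ℤ.- i)
    h*h⁻¹≈1 (+ N) = begin
      coeff (mulL h h⁻¹) (+ N)
        ≈⟨ coeff-mulL (+ N) (proj₁ δh) (coeff-below-ord h⁻¹) ℤ.≤-refl ℤ.≤-refl ⟩
      sumZ 1ℤ (+ N ℤ.- -1ℤ) (λ i → coeff h i * coeff h⁻¹ (+ N ℤ.- i))
        ≡⟨ sumZ≡sumN 1ℤ (+ N ℤ.- -1ℤ) (λ i → coeff h i * coeff h⁻¹ (+ N ℤ.- i))
                     (count (+ N)) ⟩
      sumN (suc N) (λ k → u k * coeff h⁻¹ (+ N ℤ.- (1ℤ ℤ.+ + k)))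
        ≈⟨ sumN-cong (suc N) (λ k k<1+N → *-congˡ {u k} (term k (ℕ.≤-pred k<1+N))) ⟩
      sumN (suc N) (λ k → u k * psInv u (N ℕ.∸ k))
        ≈⟨ u*psInv≈1 N ⟩
      coeff oneL (+ N)
        ∎
      where
      count : ∀ x → x ℤ.- -1ℤ ℤ.- 1ℤ ℤ.+ 1ℤ ≡ 1ℤ ℤ.+ x
      count x = solve (x ∷ [])
      regroup : ∀ x y → x ℤ.- (1ℤ ℤ.+ y) ≡ x ℤ.- y ℤ.- 1ℤ
      regroup x y = solve (x ∷ y ∷ [])
      term : ∀ k → k ℕ.≤ N → coeff h⁻¹ (+ N ℤ.- (1ℤ ℤ.+ + k)) ≈ psInv u (N ℕ.∸ k)
      term k k≤N = trans (reflexive (≡.cong (coeff h⁻¹) index)) (coeff-h⁻¹ (N ℕ.∸ k))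
        where
        index : + N ℤ.- (1ℤ ℤ.+ + k) ≡ + (N ℕ.∸ k) ℤ.- 1ℤ
        index = ≡.trans (regroup (+ N) (+ k))
                        (≡.cong (ℤ._- 1ℤ) (≡.trans (ℤ.m-n≡m⊖n N k) (ℤ.⊖-≥ k≤N)))

    h*[h⁻¹*s]≈s : ∀ s → mulL h (mulL h⁻¹ s) ≈L s
    h*[h⁻¹*s]≈s s = ≈L.trans (≈L.sym (mulL-assoc h h⁻¹ s))
                    (≈L.trans (mulL-cong h*h⁻¹≈1 (≈L.refl {s})) (mulL-identityˡ s))

    h*powZ : ∀ z → mulL h (powZ h z) ≈L powZ h (1ℤ ℤ.+ z)
    h*powZ (+ n)        = ≈L.refl {powN h (suc n)}
    h*powZ -[1+ zero ]  = h*[h⁻¹*s]≈s oneL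
    h*powZ -[1+ suc n ] = h*[h⁻¹*s]≈s (powN h⁻¹ (suc n))

    powZ-cong : ∀ {a b} → a ≡ b → powZ h a ≈L powZ h b
    powZ-cong ≡.refl = ≈L.refl

    powN*powZ : ∀ k m → mulL (powN h k) (powZ h m) ≈L powZ h (+ k ℤ.+ m)
    powN*powZ zero    m = ≈L.trans (mulL-identityˡ (powZ h m)) (powZ-cong (≡.sym (ℤ.+-identityˡ m)))
    powN*powZ (suc k) m =
      ≈L.trans (mulL-assoc h (powN h k) (powZ h m))
      (≈L.trans (mulL-cong (≈L.refl {h}) (powN*powZ k m))
      (≈L.trans (h*powZ (+ k ℤ.+ m))
                (powZ-cong (≡.sym (ℤ.+-assoc 1ℤ (+ k) m)))))

    powZ*powZ : ∀ {k} m → 0ℤ ≤ k → mulL (powZ h k) (powZ h m) ≈L powZ h (k ℤ.+ m)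
    powZ*powZ {+ k} m _ = powN*powZ k m

  -- The recurrence of an associated sequence

  -- Reading Z b a as the coefficient of λ_a / ⌊a⌉! in q_b, the recurrence says
  -- f(D) q_b = ⌊b⌉ q_{b-1}, since D^k (λ_{m+k} / ⌊m+k⌉!) = λ_m / ⌊m⌉!.
  record SolvesDeltaRecurrence (f : LS) (Z : ℤ → ℤ → K) : Set ℓ where
    field
      triangular : ∀ b a → b < a → Z b a ≈ 0#
      recurrence : ∀ m b → sumZ 1ℤ (b ℤ.- m) (λ k → coeff f k * Z b (m ℤ.+ k)) ≈
                           brk b * Z (b ℤ.- 1ℤ) m

  module _ {f : LS} (f₁≉0 : coeff f 1ℤ ≉ 0#) where

    higherTerms : (ℤ → ℤ → K) → ℤ → ℤ → K
    higherTerms W e a = sumZ (1ℤ ℤ.+ 1ℤ) (a ℤ.+ e ℤ.- (a ℤ.- 1ℤ))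
                             (λ k → coeff f k * W (a ℤ.+ e) (a ℤ.- 1ℤ ℤ.+ k))

    diagonal-step : ∀ {W} → SolvesDeltaRecurrence f W → ∀ e a → 0ℤ ≤ e →
                    coeff f 1ℤ * W (a ℤ.+ e) a + higherTerms W e a ≈
                    brk (a ℤ.+ e) * W (a ℤ.- 1ℤ ℤ.+ e) (a ℤ.- 1ℤ)
    diagonal-step {W} W-sol e a 0≤e = begin
      coeff f 1ℤ * W (a ℤ.+ e) a + higherTerms W e a
        ≡⟨ ≡.cong (λ x → coeff f 1ℤ * W (a ℤ.+ e) x + higherTerms W e a) a-1+1≡a ⟨
      coeff f 1ℤ * W (a ℤ.+ e) (a ℤ.- 1ℤ ℤ.+ 1ℤ) + higherTerms W e a
        ≈⟨ sumZ-peelˡ (λ k → coeff f k * W (a ℤ.+ e) (a ℤ.- 1ℤ ℤ.+ k)) 1≤e+1 ⟨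
      sumZ 1ℤ (a ℤ.+ e ℤ.- (a ℤ.- 1ℤ)) (λ k → coeff f k * W (a ℤ.+ e) (a ℤ.- 1ℤ ℤ.+ k))
        ≈⟨ SolvesDeltaRecurrence.recurrence W-sol (a ℤ.- 1ℤ) (a ℤ.+ e) ⟩
      brk (a ℤ.+ e) * W (a ℤ.+ e ℤ.- 1ℤ) (a ℤ.- 1ℤ)
        ≡⟨ ≡.cong (λ x → brk (a ℤ.+ e) * W x (a ℤ.- 1ℤ)) (solve (a ∷ e ∷ [])) ⟩
      brk (a ℤ.+ e) * W (a ℤ.- 1ℤ ℤ.+ e) (a ℤ.- 1ℤ)
        ∎
      where
      a-1+1≡a : a ℤ.- 1ℤ ℤ.+ 1ℤ ≡ a
      a-1+1≡a = solve (a ∷ [])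
      1≤e+1 : 1ℤ ≤ a ℤ.+ e ℤ.- (a ℤ.- 1ℤ)
      1≤e+1 = ≤-translate 0≤e (solve (a ∷ e ∷ []))

    solutions-agree : ∀ {Z Z′} → SolvesDeltaRecurrence f Z → SolvesDeltaRecurrence f Z′ →
                      (∀ b → Z b 0ℤ ≈ Z′ b 0ℤ) → ∀ b a → Z b a ≈ Z′ b a
    solutions-agree {Z} {Z′} Z-sol Z′-sol column₀ b a =
      agree-below (suc (toℕ⁺ (b ℤ.- a))) b a (i<1+toℕ⁺i (b ℤ.- a))
      where
      module Z  = SolvesDeltaRecurrence Z-sol
      module Z′ = SolvesDeltaRecurrence Z′-sol

      diagonal : ∀ d → (∀ b a → b ℤ.- a < + d → Z b a ≈ Z′ b a) →
                 ∀ a → Z (a ℤ.+ + d) a ≈ Z′ (a ℤ.+ + d) a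
      diagonal d closer-agree =
        ℤ-bidirectional-induction (λ a → Z (a ℤ.+ + d) a ≈ Z′ (a ℤ.+ + d) a)
                                  (column₀ (+ d)) up down
        where
        0≤d : 0ℤ ≤ + d
        0≤d = ℤ.+≤+ (ℕ.z≤n {d})
        higherTerms-agree : ∀ a → higherTerms Z (+ d) a ≈ higherTerms Z′ (+ d) a
        higherTerms-agree a = sumZ-cong (1ℤ ℤ.+ 1ℤ) (a ℤ.+ + d ℤ.- (a ℤ.- 1ℤ)) (λ k 2≤k _ →
          *-congˡ {coeff f k} (closer-agree (a ℤ.+ + d) (a ℤ.- 1ℤ ℤ.+ k)
                                            (<-translate (ℤ.suc[i]≤j⇒i<j 2≤k) (distance (+ d) k))))
          where
          distance : ∀ e k → e ℤ.- (a ℤ.+ e ℤ.- (a ℤ.- 1ℤ ℤ.+ k)) ≡ k ℤ.- 1ℤ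
          distance e k = solve (e ∷ a ∷ k ∷ [])
        up : ∀ a → Z (a ℤ.- 1ℤ ℤ.+ + d) (a ℤ.- 1ℤ) ≈ Z′ (a ℤ.- 1ℤ ℤ.+ + d) (a ℤ.- 1ℤ) →
                   Z (a ℤ.+ + d) a ≈ Z′ (a ℤ.+ + d) a
        up a below = *-cancelˡ f₁≉0 (+-cancelʳ (higherTerms Z (+ d) a) _ _ (begin
          coeff f 1ℤ * Z (a ℤ.+ + d) a + higherTerms Z (+ d) a
            ≈⟨ diagonal-step Z-sol (+ d) a 0≤d ⟩
          brk (a ℤ.+ + d) * Z (a ℤ.- 1ℤ ℤ.+ + d) (a ℤ.- 1ℤ)
            ≈⟨ *-congˡ below ⟩
          brk (a ℤ.+ + d) * Z′ (a ℤ.- 1ℤ ℤ.+ + d) (a ℤ.- 1ℤ)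
            ≈⟨ diagonal-step Z′-sol (+ d) a 0≤d ⟨
          coeff f 1ℤ * Z′ (a ℤ.+ + d) a + higherTerms Z′ (+ d) a
            ≈⟨ +-congˡ (higherTerms-agree a) ⟨
          coeff f 1ℤ * Z′ (a ℤ.+ + d) a + higherTerms Z (+ d) a
            ∎))
        down : ∀ a → Z (a ℤ.+ + d) a ≈ Z′ (a ℤ.+ + d) a →
               Z (a ℤ.- 1ℤ ℤ.+ + d) (a ℤ.- 1ℤ) ≈ Z′ (a ℤ.- 1ℤ ℤ.+ + d) (a ℤ.- 1ℤ)
        down a above = *-cancelˡ (brk-nonzero (a ℤ.+ + d)) (begin
          brk (a ℤ.+ + d) * Z (a ℤ.- 1ℤ ℤ.+ + d) (a ℤ.- 1ℤ)
            ≈⟨ diagonal-step Z-sol (+ d) a 0≤d ⟨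
          coeff f 1ℤ * Z (a ℤ.+ + d) a + higherTerms Z (+ d) a
            ≈⟨ +-cong (*-congˡ above) (higherTerms-agree a) ⟩
          coeff f 1ℤ * Z′ (a ℤ.+ + d) a + higherTerms Z′ (+ d) a
            ≈⟨ diagonal-step Z′-sol (+ d) a 0≤d ⟩
          brk (a ℤ.+ + d) * Z′ (a ℤ.- 1ℤ ℤ.+ + d) (a ℤ.- 1ℤ)
            ∎)

      agree-below : ∀ d b a → b ℤ.- a < + d → Z b a ≈ Z′ b a
      agree-below zero    b a b-a<0 = trans (Z.triangular b a b<a) (sym (Z′.triangular b a b<a))
        where
        b<a : b < a
        b<a = <-translate b-a<0 (solve (a ∷ b ∷ []))
      agree-below (suc d) b a b-a<1+d with b ℤ.- a ℤ.<? + d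
      ... | yes b-a<d = agree-below d b a b-a<d
      ... | no  b-a≮d = ≡.subst (λ x → Z x a ≈ Z′ x a) a+d≡b (diagonal d (agree-below d) a)
        where
        b-a≡d : b ℤ.- a ≡ + d
        b-a≡d = ℤ.≤-antisym (ℤ.i<j⇒i≤pred[j] b-a<1+d) (ℤ.≮⇒≥ b-a≮d)
        a+d≡b : a ℤ.+ + d ≡ b
        a+d≡b = ≡.trans (≡.cong (ℤ._+_ a) (≡.sym b-a≡d)) (solve (a ∷ b ∷ []))

  -- Composition with the compositional inverse

  coeff-comp : ∀ g h m → coeff (comp g h) m ≈
               sumZ (LS.ord g) m (λ a → coeff g a * coeff (powZ h a) m)
  coeff-comp g h m with m ℤ.<? LS.ord g
  ... | yes m<ord = sym (sumZ-empty (λ a → coeff g a * coeff (powZ h a) m) m<ord)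
  ... | no  _     = refl

  IsDelta⇒ord≤1 : ∀ {f} → IsDelta f → LS.ord f ≤ 1ℤ
  IsDelta⇒ord≤1 {f} (_ , f₁≉0) = ℤ.≮⇒≥ (λ 1<ord → f₁≉0 (coeff-below-ord f 1ℤ 1<ord))

  module PowerCoefficients {f h : LS} (δf : IsDelta f) (δh : IsDelta h) (f∘h≈D : comp f h ≈L DL) where
    open DeltaPowers h δh

    Q : ℤ → ℤ → K
    Q a b = coeff (powZ h a) b

    coeff-f∘h : ∀ j W → j ≤ W → coeff (comp f h) j ≈ sumZ 1ℤ W (λ k → coeff f k * Q k j)
    coeff-f∘h j W j≤W = trans (coeff-comp f h j)
      (sumZ-window (λ k → coeff f k * Q k j)
        (λ k k<1 → x≈0⇒x*y≈0 (proj₁ δf k k<1))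
        (λ k j<k → y≈0⇒x*y≈0 (powZ-vanishesBelow k j j<k))
        (IsDelta⇒ord≤1 δf) ℤ.≤-refl ℤ.≤-refl j≤W)

    f∘h-vanishesBelow : VanishesBelow (comp f h) 1ℤ
    f∘h-vanishesBelow i i<1 = trans (f∘h≈D i) (proj₂ (monomial-isMonomial 1ℤ) i (ℤ.<⇒≢ i<1))

    Q-convolution : ∀ k m b → 1ℤ ≤ k →
                    sumZ 1ℤ (b ℤ.- m) (λ i → Q k i * Q m (b ℤ.- i)) ≈ Q (m ℤ.+ k) b
    Q-convolution k m b 1≤k = begin
      sumZ 1ℤ (b ℤ.- m) (λ i → Q k i * Q m (b ℤ.- i))
        ≈⟨ coeff-mulL b (powZ-vanishesBelow k) (powZ-vanishesBelow m) 1≤k ℤ.≤-refl ⟨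
      coeff (mulL (powZ h k) (powZ h m)) b
        ≈⟨ powZ*powZ m (ℤ.≤-trans (ℤ.+≤+ ℕ.z≤n) 1≤k) b ⟩
      Q (k ℤ.+ m) b
        ≡⟨ ≡.cong (λ a → Q a b) (ℤ.+-comm k m) ⟩
      Q (m ℤ.+ k) b
        ∎

    Q-recurrence : ∀ m b → sumZ 1ℤ (b ℤ.- m) (λ k → coeff f k * Q (m ℤ.+ k) b) ≈ Q m (b ℤ.- 1ℤ)
    Q-recurrence m b = begin
      sumZ 1ℤ W (λ k → coeff f k * Q (m ℤ.+ k) b)
        ≈⟨ sumZ-cong 1ℤ W (λ k 1≤k _ → *-congˡ {coeff f k} (Q-convolution k m b 1≤k)) ⟨
      sumZ 1ℤ W (λ k → coeff f k * sumZ 1ℤ W (λ i → Q k i * Q m (b ℤ.- i)))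
        ≈⟨ sumZ-cong 1ℤ W (λ k _ _ → sumZ-*ˡ 1ℤ W (coeff f k) (λ i → Q k i * Q m (b ℤ.- i))) ⟩
      sumZ 1ℤ W (λ k → sumZ 1ℤ W (λ i → coeff f k * (Q k i * Q m (b ℤ.- i))))
        ≈⟨ sumZ-comm 1ℤ W 1ℤ W (λ k i → coeff f k * (Q k i * Q m (b ℤ.- i))) ⟩
      sumZ 1ℤ W (λ i → sumZ 1ℤ W (λ k → coeff f k * (Q k i * Q m (b ℤ.- i))))
        ≈⟨ sumZ-cong 1ℤ W (λ i _ _ → regroup i) ⟩
      sumZ 1ℤ W (λ i → sumZ 1ℤ W (λ k → coeff f k * Q k i) * Q m (b ℤ.- i))
        ≈⟨ sumZ-cong 1ℤ W (λ i _ i≤W → *-congʳ {Q m (b ℤ.- i)} (coeff-f∘h i W i≤W)) ⟨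
      sumZ 1ℤ W (λ i → coeff (comp f h) i * Q m (b ℤ.- i))
        ≈⟨ coeff-mulL b f∘h-vanishesBelow (powZ-vanishesBelow m) ℤ.≤-refl ℤ.≤-refl ⟨
      coeff (mulL (comp f h) (powZ h m)) b
        ≈⟨ mulL-cong f∘h≈D (≈L.refl {powZ h m}) b ⟩
      coeff (mulL DL (powZ h m)) b
        ≈⟨ coeff-mulL-monomial (monomial-isMonomial 1ℤ) (powZ h m) b ⟩
      Q m (b ℤ.- 1ℤ)
        ∎
      where
      W : ℤ
      W = b ℤ.- m
      regroup : ∀ i → sumZ 1ℤ W (λ k → coeff f k * (Q k i * Q m (b ℤ.- i))) ≈
                      sumZ 1ℤ W (λ k → coeff f k * Q k i) * Q m (b ℤ.- i)
      regroup i =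
        trans (sumZ-cong 1ℤ W (λ k _ _ → sym (*-assoc (coeff f k) (Q k i) (Q m (b ℤ.- i)))))
              (sym (sumZ-*ʳ 1ℤ W (Q m (b ℤ.- i)) (λ k → coeff f k * Q k i)))

    scaledQ-solves : SolvesDeltaRecurrence f (λ b a → Q a b * brkFact b)
    scaledQ-solves = record
      { triangular = λ b a b<a → x≈0⇒x*y≈0 (powZ-vanishesBelow a b b<a)
      ; recurrence = recurrence
      }
      where
      recurrence : ∀ m b → sumZ 1ℤ (b ℤ.- m) (λ k → coeff f k * (Q (m ℤ.+ k) b * brkFact b)) ≈
                           brk b * (Q m (b ℤ.- 1ℤ) * brkFact (b ℤ.- 1ℤ))
      recurrence m b = begin
        sumZ 1ℤ (b ℤ.- m) (λ k → coeff f k * (Q (m ℤ.+ k) b * brkFact b))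
          ≈⟨ sumZ-cong 1ℤ (b ℤ.- m) (λ k _ _ → sym (*-assoc (coeff f k) (Q (m ℤ.+ k) b) (brkFact b))) ⟩
        sumZ 1ℤ (b ℤ.- m) (λ k → coeff f k * Q (m ℤ.+ k) b * brkFact b)
          ≈⟨ sumZ-*ʳ 1ℤ (b ℤ.- m) (brkFact b) (λ k → coeff f k * Q (m ℤ.+ k) b) ⟨
        sumZ 1ℤ (b ℤ.- m) (λ k → coeff f k * Q (m ℤ.+ k) b) * brkFact b
          ≈⟨ *-cong (Q-recurrence m b) (brkFact-unfold b) ⟩
        Q m (b ℤ.- 1ℤ) * (brk b * brkFact (b ℤ.- 1ℤ))
          ≈⟨ x∙yz≈y∙xz _ _ _ ⟩
        brk b * (Q m (b ℤ.- 1ℤ) * brkFact (b ℤ.- 1ℤ))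
          ∎

  -- The action on I^α

  coeffI-above-top : ∀ q b → Elt.top q < b → coeffI q b ≈ 0#
  coeffI-above-top q b top<b = reflexive (if-true (Elt.top q ℤ.<? b) top<b)

  HasDegree⇒≤top : ∀ q {a} → HasDegree q a → a ≤ Elt.top q
  HasDegree⇒≤top q {a} (qa≉0 , _) = ℤ.≮⇒≥ (λ top<a → qa≉0 (coeffI-above-top q a top<a))

  coeffI-act : ∀ g q m → coeffI (act g q) m ≈
               sumZ (LS.ord g) (Elt.top q ℤ.- m)
                    (λ a → coeff g a * coeffI q (m ℤ.+ a) * ratio (m ℤ.+ a) a)
  coeffI-act g q m with Elt.top q ℤ.- LS.ord g ℤ.<? m
  ... | yes top<m = sym (sumZ-empty (λ a → coeff g a * coeffI q (m ℤ.+ a) * ratio (m ℤ.+ a) a)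
                                    (i-j<k⇒i-k<j (Elt.top q) (LS.ord g) m top<m))
  ... | no  _     = refl

  coeffI-scaleE : ∀ k q m → coeffI (scaleE k q) m ≈ k * coeffI q m
  coeffI-scaleE k q m with Elt.top q ℤ.<? m
  ... | yes _ = sym (zeroʳ k)
  ... | no  _ = refl

  coeffI-trunc : ∀ q x → 0ℤ ≤ x → coeffI (trunc q) x ≈ coeffI q x
  coeffI-trunc q x 0≤x with Elt.top q ℤ.<? x
  ... | yes _ = refl
  ... | no  _ = reflexive (if-false (x ℤ.<? 0ℤ) (ℤ.≤⇒≯ 0≤x))

  pair-act-trunc : ∀ {g} → IsDifferential g → ∀ q → pair (act g (trunc q)) ≈ pair (act g q)
  pair-act-trunc {g} g≈0 q = begin
    pair (act g (trunc q))                     ≈⟨ coeffI-act g (trunc q) 0ℤ ⟩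
    sumZ (LS.ord g) (Elt.top q ℤ.- 0ℤ) (T (trunc q))
      ≈⟨ sumZ-cong (LS.ord g) (Elt.top q ℤ.- 0ℤ) (λ a _ _ → *-congʳ {ratio (0ℤ ℤ.+ a) a} (term a)) ⟩
    sumZ (LS.ord g) (Elt.top q ℤ.- 0ℤ) (T q)  ≈⟨ coeffI-act g q 0ℤ ⟨
    pair (act g q)                             ∎
    where
    T : Elt → ℤ → K
    T r a = coeff g a * coeffI r (0ℤ ℤ.+ a) * ratio (0ℤ ℤ.+ a) a
    term : ∀ a → coeff g a * coeffI (trunc q) (0ℤ ℤ.+ a) ≈ coeff g a * coeffI q (0ℤ ℤ.+ a)
    term a with a ℤ.<? 0ℤ
    ... | yes a<0 = trans (x≈0⇒x*y≈0 (g≈0 a a<0)) (sym (x≈0⇒x*y≈0 (g≈0 a a<0)))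
    ... | no  a≮0 = *-congˡ (coeffI-trunc q (0ℤ ℤ.+ a) 0≤0+a)
      where
      0≤0+a : 0ℤ ≤ 0ℤ ℤ.+ a
      0≤0+a = ≡.subst (0ℤ ≤_) (≡.sym (ℤ.+-identityˡ a)) (ℤ.≮⇒≥ a≮0)

  pair-act0 : ∀ {g} → IsDifferential g → ∀ q → pair (act0 g (trunc q)) ≈ pair (act g q)
  pair-act0 {g} g≈0 q = begin
    pair (trunc (act g (trunc (trunc q))))  ≈⟨ coeffI-trunc (act g (trunc (trunc q))) 0ℤ ℤ.≤-refl ⟩
    pair (act g (trunc (trunc q)))          ≈⟨ pair-act-trunc g≈0 (trunc q) ⟩
    pair (act g (trunc q))                  ≈⟨ pair-act-trunc g≈0 q ⟩
    pair (act g q)                          ∎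

  module AssociatedCoefficients {f : LS} (δf : IsDelta f) (p : ℤ → Elt) (p-assoc : IsAssociated f p) where

    degree : ∀ a → HasDegree (p a) a
    degree = proj₁ p-assoc

    pair-p₀ : pair (p 0ℤ) ≈ 1#
    pair-p₀ = proj₁ (proj₂ p-assoc)

    pair-p≢0 : ∀ a → a ≢ 0ℤ → pair (p a) ≈ 0#
    pair-p≢0 = proj₁ (proj₂ (proj₂ p-assoc))

    f-lowers : ∀ a → act f (p a) ≈E scaleE (brk a) (p (a ℤ.- 1ℤ))
    f-lowers = proj₁ (proj₂ (proj₂ (proj₂ p-assoc)))

    p-triangular : ∀ b a → b < a → coeffI (p b) a ≈ 0#
    p-triangular b = proj₂ (degree b)

    X : ℤ → ℤ → K
    X b a = coeffI (p b) a * brkFact a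

    X-solves : SolvesDeltaRecurrence f X
    X-solves = record
      { triangular = λ b a b<a → x≈0⇒x*y≈0 (p-triangular b a b<a)
      ; recurrence = recurrence
      }
      where
      recurrence : ∀ m b → sumZ 1ℤ (b ℤ.- m) (λ k → coeff f k * X b (m ℤ.+ k)) ≈
                           brk b * X (b ℤ.- 1ℤ) m
      recurrence m b = begin
        sumZ 1ℤ (b ℤ.- m) (λ k → coeff f k * X b (m ℤ.+ k))
          ≈⟨ sumZ-cong 1ℤ (b ℤ.- m) (λ k _ _ → term k) ⟨
        sumZ 1ℤ (b ℤ.- m) (λ k → T k * brkFact m)
          ≈⟨ sumZ-*ʳ 1ℤ (b ℤ.- m) (brkFact m) T ⟨
        sumZ 1ℤ (b ℤ.- m) T * brkFact m
          ≈⟨ *-congʳ (sumZ-window T T-below T-above ℤ.≤-refl ℤ.≤-refl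
                                  (IsDelta⇒ord≤1 δf) b-m≤top-m) ⟩
        sumZ (LS.ord f) (Elt.top (p b) ℤ.- m) T * brkFact m
          ≈⟨ *-congʳ (coeffI-act f (p b) m) ⟨
        coeffI (act f (p b)) m * brkFact m
          ≈⟨ *-congʳ (trans (f-lowers b m) (coeffI-scaleE (brk b) (p (b ℤ.- 1ℤ)) m)) ⟩
        brk b * coeffI (p (b ℤ.- 1ℤ)) m * brkFact m
          ≈⟨ *-assoc _ _ _ ⟩
        brk b * X (b ℤ.- 1ℤ) m
          ∎
        where
        T : ℤ → K
        T k = coeff f k * coeffI (p b) (m ℤ.+ k) * ratio (m ℤ.+ k) k
        T-below : ∀ k → k < 1ℤ → T k ≈ 0#
        T-below k k<1 = x≈0⇒x*y≈0 (x≈0⇒x*y≈0 (proj₁ δf k k<1))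
        T-above : ∀ k → b ℤ.- m < k → T k ≈ 0#
        T-above k b-m<k =
          x≈0⇒x*y≈0 (y≈0⇒x*y≈0 (p-triangular b (m ℤ.+ k) b<m+k))
          where
          b<m+k : b < m ℤ.+ k
          b<m+k = <-translate b-m<k (solve (m ∷ k ∷ b ∷ []))
        b-m≤top-m : b ℤ.- m ≤ Elt.top (p b) ℤ.- m
        b-m≤top-m = ℤ.+-monoˡ-≤ (ℤ.- m) (HasDegree⇒≤top (p b) (degree b))
        term : ∀ k → T k * brkFact m ≈ coeff f k * X b (m ℤ.+ k)
        term k = begin
          fₖpₖ * ratio (m ℤ.+ k) k * brkFact m
            ≈⟨ *-assoc _ _ _ ⟩
          fₖpₖ * (ratio (m ℤ.+ k) k * brkFact m)
            ≡⟨ ≡.cong (λ x → fₖpₖ * (ratio (m ℤ.+ k) k * brkFact x)) m≡m+k-k ⟩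
          fₖpₖ * (ratio (m ℤ.+ k) k * brkFact (m ℤ.+ k ℤ.- k))
            ≈⟨ *-congˡ (ratio-*-brkFact (m ℤ.+ k) k) ⟩
          fₖpₖ * brkFact (m ℤ.+ k)
            ≈⟨ *-assoc _ _ _ ⟩
          coeff f k * X b (m ℤ.+ k)
            ∎
          where
          fₖpₖ : K
          fₖpₖ = coeff f k * coeffI (p b) (m ℤ.+ k)
          m≡m+k-k : m ≡ m ℤ.+ k ℤ.- k
          m≡m+k-k = solve (m ∷ k ∷ [])

    pair-act : ∀ g b → pair (act g (p b)) ≈ sumZ (LS.ord g) b (λ a → coeff g a * X b a)
    pair-act g b = begin
      pair (act g (p b))
        ≈⟨ coeffI-act g (p b) 0ℤ ⟩
      sumZ (LS.ord g) (Elt.top (p b) ℤ.- 0ℤ)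
           (λ a → coeff g a * coeffI (p b) (0ℤ ℤ.+ a) * ratio (0ℤ ℤ.+ a) a)
        ≈⟨ sumZ-cong (LS.ord g) (Elt.top (p b) ℤ.- 0ℤ) (λ a _ _ → term a) ⟩
      sumZ (LS.ord g) (Elt.top (p b) ℤ.- 0ℤ) G
        ≈⟨ sumZ-window G G-below G-above ℤ.≤-refl b≤top ℤ.≤-refl ℤ.≤-refl ⟩
      sumZ (LS.ord g) b G
        ∎
      where
      G : ℤ → K
      G a = coeff g a * X b a
      G-below : ∀ a → a < LS.ord g → G a ≈ 0#
      G-below a a<ord = x≈0⇒x*y≈0 (coeff-below-ord g a a<ord)
      G-above : ∀ a → b < a → G a ≈ 0#
      G-above a b<a = y≈0⇒x*y≈0 (x≈0⇒x*y≈0 (p-triangular b a b<a))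
      b≤top : b ≤ Elt.top (p b) ℤ.- 0ℤ
      b≤top = ≡.subst (b ≤_) (≡.sym (ℤ.+-identityʳ (Elt.top (p b))))
                      (HasDegree⇒≤top (p b) (degree b))
      term : ∀ a → coeff g a * coeffI (p b) (0ℤ ℤ.+ a) * ratio (0ℤ ℤ.+ a) a ≈ G a
      term a = begin
        coeff g a * coeffI (p b) (0ℤ ℤ.+ a) * ratio (0ℤ ℤ.+ a) a
          ≡⟨ ≡.cong (λ x → coeff g a * coeffI (p b) x * ratio x a) (ℤ.+-identityˡ a) ⟩
        coeff g a * coeffI (p b) a * ratio a a
          ≈⟨ *-congˡ (ratio-self a) ⟩
        coeff g a * coeffI (p b) a * brkFact a
          ≈⟨ *-assoc _ _ _ ⟩
        G a
          ∎

  -- The expansion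

  module Expansion {f : LS} (δf : IsDelta f) (p : ℤ → Elt) (p-assoc : IsAssociated f p)
                   {h : LS} (δh : IsDelta h) (f∘h≈D : comp f h ≈L DL) where
    open PowerCoefficients δf δh f∘h≈D
    open AssociatedCoefficients δf p p-assoc

    column₀≢0 : ∀ b → b ≢ 0ℤ → X b 0ℤ ≈ Q 0ℤ b * brkFact b
    column₀≢0 b b≢0 = trans (*-congʳ (pair-p≢0 b b≢0)) (trans (zeroˡ _) (sym Q0b*b!≈0))
      where
      Q0b*b!≈0 : Q 0ℤ b * brkFact b ≈ 0#
      Q0b*b!≈0 = x≈0⇒x*y≈0 (proj₂ (monomial-isMonomial 0ℤ) b b≢0)

    column₀ : ∀ b → X b 0ℤ ≈ Q 0ℤ b * brkFact b
    column₀ (+ zero)  = *-congʳ (trans pair-p₀ (sym (proj₁ (monomial-isMonomial 0ℤ))))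
    column₀ (+ suc n) = column₀≢0 (+ suc n) (λ ())
    column₀ -[1+ n ]  = column₀≢0 -[1+ n ] (λ ())

    X≈scaledQ : ∀ b a → X b a ≈ Q a b * brkFact b
    X≈scaledQ = solutions-agree (proj₂ δf) X-solves scaledQ-solves column₀

    Q≈X/brkFact : ∀ b a → Q a b ≈ X b a * brkFact b ⁻¹
    Q≈X/brkFact b a = begin
      Q a b                               ≈⟨ *-identityʳ _ ⟨
      Q a b * 1#                          ≈⟨ *-congˡ (⁻¹-inverse _ (brkFact-nonzero b)) ⟨
      Q a b * (brkFact b * brkFact b ⁻¹)  ≈⟨ *-assoc _ _ _ ⟨
      Q a b * brkFact b * brkFact b ⁻¹    ≈⟨ *-congʳ (X≈scaledQ b a) ⟨
      X b a * brkFact b ⁻¹                ∎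

    coeff-comp-expansion : ∀ g b → coeff (comp g h) b ≈ pair (act g (p b)) * brkFact b ⁻¹
    coeff-comp-expansion g b = begin
      coeff (comp g h) b
        ≈⟨ coeff-comp g h b ⟩
      sumZ (LS.ord g) b (λ a → coeff g a * Q a b)
        ≈⟨ sumZ-cong (LS.ord g) b (λ a _ _ →
             trans (*-congˡ {coeff g a} (Q≈X/brkFact b a)) (sym (*-assoc _ _ _))) ⟩
      sumZ (LS.ord g) b (λ a → coeff g a * X b a * brkFact b ⁻¹)
        ≈⟨ sumZ-*ʳ (LS.ord g) b (brkFact b ⁻¹) (λ a → coeff g a * X b a) ⟨
      sumZ (LS.ord g) b (λ a → coeff g a * X b a) * brkFact b ⁻¹
        ≈⟨ *-congʳ (pair-act g b) ⟨
      pair (act g (p b)) * brkFact b ⁻¹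
        ∎

    pair-act-below-ord : ∀ g b → b < LS.ord g → pair (act g (p b)) ≈ 0#
    pair-act-below-ord g b b<ord = trans (pair-act g b) (sumZ-empty (λ a → coeff g a * X b a) b<ord)

mainTheorem16 : ∀ {c ℓ} (F : CharZeroField c ℓ) →
  let open CharZeroField F
      open Umbral F
  in (f : LS) → IsDelta f → (p : ℤ → Elt) → IsAssociated f p →
     (finv : LS) → IsCompInverse f finv →
     ((g : LS) →
        Σ ℤ (λ N → ∀ b → b < N → pair (act g (p b)) ≈ 0#)
        × (∀ b → coeff (comp g finv) b ≈ (pair (act g (p b)) * (brkFact b) ⁻¹)))
     ×
     ((g : LS) → IsDifferential g →
        Σ ℤ (λ N → ∀ b → b < N → pair (act0 g (trunc (p b))) ≈ 0#)
        × (∀ b → coeff (comp g finv) b ≈ (pair (act0 g (trunc (p b))) * (brkFact b) ⁻¹)))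
mainTheorem16 F f δf p p-assoc finv (δh , f∘h≈D , _) =
    (λ g → (LS.ord g , pair-act-below-ord g) , coeff-comp-expansion g)
  , (λ g g-diff →
        (LS.ord g , λ b b<ord → trans (pair-act0 F g-diff (p b)) (pair-act-below-ord g b b<ord))
      , λ b → trans (coeff-comp-expansion g b) (*-congʳ (sym (pair-act0 F g-diff (p b)))))
  where
  open CharZeroField F using (trans; sym; *-congʳ)
  open Umbral F using (module LS)
  open Expansion F δf p p-assoc δh f∘h≈D
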